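{- Let $p,q\ge 1$ be integers and $n=pq$. Let $Z_e(p,q)$ denote the number of $n\times n$ permutation matrices $P$ such that $P^{\Gamma_p}=P$. Then \[ Z_e(p,q)=\sum \frac{q!}{\prod_{\pi\in S_p} a_\pi!}\ \prod_{i,j=1}^{p} I\Bigl(\sum_{\pi\in S_p:\ \pi(i)=j} a_\pi\Bigr), \] where the sum runs over all families of nonnegative integers $(a_\pi)_{\pi\in S_p}$ with $\sum_{\pi\in S_p} a_\pi=q$.
   Context: A permutation matrix of size $n$ is an $n\times n$ $\{0,1\}$-matrix with exactly one $1$ in each row and each column. $S_p$ is the set of permutations of $\{1,\dots,p\}$. For $r\ge 0$, $I(r)$ denotes the number of permutations $\sigma$ of $\{1,\dots,r\}$ with $\sigma^2=\mathrm{id}$ (including the identity; $I(0)=1$), i.e. $I(r)=\sum_{j\ \mathrm{even},\,0\le j\le r}\binom{r}{j}\frac{j!}{2^{j/2}(j/2)!}$. For an $n\times n$ matrix $M$ with $n=pq$, view $M$ as a $p\times p$ array of $q\times q$ blocks $\mathcal{B}_{i,j}$; the partial transpose $M^{\Gamma_p}$ is the matrix obtained by replacing each block $\mathcal{B}_{i,j}$ by its transpose $\mathcal{B}_{i,j}^T$, keeping blocks in place. -}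

module Defs where

open import Data.Bool using (Bool; true; false; if_then_else_)
open import Data.Nat using (ℕ; zero; suc; _+_; _*_; _/_; NonZero; _≟_)
open import Data.Nat.Properties using (m*n≢0)
open import Data.Nat.Properties using (_!≢0)
open import Data.Nat using (_!)
open import Data.Fin using (Fin; combine; remQuot)
import Data.Fin as F
open import Data.Fin.Properties using (all?)
open import Data.Vec.Functional using () renaming (_∷_ to _◂_)
open import Data.List using (List; []; _∷_; [_]; map; concatMap; filter; length; upTo; allFin)
open import Data.Nat.ListAction using (sum; product)
open import Data.Product using (_,_; _×_)
open import Relation.Nullary using (Dec; does)
open import Relation.Nullary.Decidable using (_×-dec_; _→-dec_)
open import Relation.Binary.PropositionalEquality using (_≡_)

funcs : ∀ {A : Set} (m : ℕ) → List A → List (Fin m → A)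
funcs zero    xs = [ (λ ()) ]
funcs (suc m) xs = concatMap (λ a → map (λ f → a ◂ f) (funcs m xs)) xs

Σ[_]_ : (m : ℕ) → (Fin m → ℕ) → ℕ
Σ[ m ] f = sum (map f (allFin m))

Π[_]_ : (m : ℕ) → (Fin m → ℕ) → ℕ
Π[ m ] f = product (map f (allFin m))

Matrix : ℕ → Set
Matrix n = Fin n → Fin n → Bool

bit : Bool → ℕ
bit true  = 1
bit false = 0

allMatrices : (n : ℕ) → List (Matrix n)
allMatrices n = funcs n (funcs n (true ∷ false ∷ []))

IsPermutationMatrix : ∀ {n} → Matrix n → Set
IsPermutationMatrix {n} M =
  (∀ i → Σ[ n ] (λ j → bit (M i j)) ≡ 1) × (∀ j → Σ[ n ] (λ i → bit (M i j)) ≡ 1)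

isPermutationMatrix? : ∀ {n} (M : Matrix n) → Dec (IsPermutationMatrix M)
isPermutationMatrix? {n} M =
  all? (λ i → Σ[ n ] (λ j → bit (M i j)) ≟ 1) ×-dec all? (λ j → Σ[ n ] (λ i → bit (M i j)) ≟ 1)

-- Partial transpose: view M (size p*q) as a p×p array of q×q blocks
-- (row index r ↦ block index i, inner index a, with r = combine i a = i*q + a)
-- and transpose each block in place.
partialTranspose : (p q : ℕ) → Matrix (p * q) → Matrix (p * q)
partialTranspose p q M r c with remQuot {p} q r | remQuot {p} q c
... | i , a | j , b = M (combine i b) (combine j a)

MatEq : ∀ {n} → Matrix n → Matrix n → Set
MatEq M N = ∀ i j → M i j ≡ N i j

matEq? : ∀ {n} (M N : Matrix n) → Dec (MatEq M N)
matEq? M N = all? (λ i → all? (λ j → Data.Bool._≟_ (M i j) (N i j)))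
  where import Data.Bool

Ze : ℕ → ℕ → ℕ
Ze p q = length (filter (λ M → isPermutationMatrix? M ×-dec matEq? (partialTranspose p q M) M)
                        (allMatrices (p * q)))

IsInjective : ∀ {m} → (Fin m → Fin m) → Set
IsInjective {m} f = ∀ i j → f i ≡ f j → i ≡ j

isInjective? : ∀ {m} (f : Fin m → Fin m) → Dec (IsInjective f)
isInjective? f = all? (λ i → all? (λ j → (f i F.≟ f j) →-dec (i F.≟ j)))

-- S_p as a list of permutations of Fin p (injective self-maps of a finite set)
Sym : (p : ℕ) → List (Fin p → Fin p)
Sym p = filter isInjective? (funcs p (allFin p))

IsInvolution : ∀ {m} → (Fin m → Fin m) → Set
IsInvolution {m} σ = ∀ i → σ (σ i) ≡ i

isInvolution? : ∀ {m} (σ : Fin m → Fin m) → Dec (IsInvolution σ)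
isInvolution? σ = all? (λ i → σ (σ i) F.≟ i)

-- I(r): number of permutations σ of {1..r} with σ² = id
-- (any σ with σ∘σ = id is automatically a permutation)
I : ℕ → ℕ
I r = length (filter isInvolution? (funcs r (allFin r)))

lookupL : ∀ {A : Set} (xs : List A) → Fin (length xs) → A
lookupL (x ∷ xs) F.zero    = x
lookupL (x ∷ xs) (F.suc k) = lookupL xs k

nSym : ℕ → ℕ
nSym p = length (Sym p)

perm : (p : ℕ) → Fin (nSym p) → (Fin p → Fin p)
perm p = lookupL (Sym p)

families : (p q : ℕ) → List (Fin (nSym p) → ℕ)
families p q = filter (λ a → Σ[ nSym p ] a ≟ q) (funcs (nSym p) (upTo (suc q)))

prodFact : ∀ {m} → (Fin m → ℕ) → ℕ
prodFact {m} a = Π[ m ] (λ k → a k !)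

prodFact-nonZero-list : (xs : List ℕ) → NonZero (product (map _! xs))
prodFact-nonZero-list []       = _
prodFact-nonZero-list (x ∷ xs) = m*n≢0 (x !) _ {{x !≢0}} {{prodFact-nonZero-list xs}}

map-map-fact : ∀ {m} (a : Fin m → ℕ) (ks : List (Fin m)) →
  product (map (λ k → a k !) ks) ≡ product (map _! (map a ks))
map-map-fact a []       = Relation.Binary.PropositionalEquality.refl
  where import Relation.Binary.PropositionalEquality
map-map-fact a (k ∷ ks) = Relation.Binary.PropositionalEquality.cong (a k ! *_) (map-map-fact a ks)
  where import Relation.Binary.PropositionalEquality

prodFact-nonZero : ∀ {m} (a : Fin m → ℕ) → NonZero (prodFact a)
prodFact-nonZero {m} a =
  Relation.Binary.PropositionalEquality.subst NonZero
    (Relation.Binary.PropositionalEquality.sym (map-map-fact a (allFin m)))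
    (prodFact-nonZero-list (map a (allFin m)))
  where import Relation.Binary.PropositionalEquality

-- multinomial coefficient q! / ∏_π a_π!  (exact division)
multinomial : ∀ {m} → ℕ → (Fin m → ℕ) → ℕ
multinomial q a = (q ! / prodFact a) {{prodFact-nonZero a}}

cnt : (p : ℕ) → (Fin (nSym p) → ℕ) → Fin p → Fin p → ℕ
cnt p a i j = Σ[ nSym p ] (λ k → if does (perm p k i F.≟ j) then a k else 0)

RHS : (p q : ℕ) → ℕ
RHS p q = sum (map (λ a → multinomial q a * Π[ p ] (λ i → Π[ p ] (λ j → I (cnt p a i j))))
                   (families p q))

module Submission where

-- Index the rows and columns of a (pq)×(pq) matrix by pairs (i, a) of a block
-- i ∈ Fin p and an offset a ∈ Fin q.  A permutation matrix is the graph of a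
-- bijection s (i, a) = (π_a i, g_i a), and the partial transpose exchanges the
-- two offsets, so P^Γ = P says exactly that each g_i is an involution of Fin q
-- preserving the colouring a ↦ π_a i; bijectivity of s then means that every
-- π_a lies in S_p (module Blocks).  Involutions of Fin q preserving a colouring
-- with classes of sizes n_j number ∏_j I(n_j) (module ColouredInvolutions,
-- removing one point at a time), so Z_e is a sum over words π ∈ S_p^q of a
-- weight that depends only on the multiplicities a_σ of the letters; a given
-- multiplicity vector is realised by q!/∏ a_σ! words (#words-*), and grouping
-- the words by it yields the right-hand side (Assembly, theorem2).

open import Defs
open import Algebra.Properties.CommutativeSemigroup using (interchange; x∙yz≈y∙xz)
open import Data.Bool using (Bool; true; false; _∧_; _∨_; not; if_then_else_)
import Data.Bool as B
open import Data.Bool.Properties using (∧-zeroʳ; ∧-identityʳ)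
open import Data.Empty using (⊥; ⊥-elim)
open import Data.Fin using (Fin; combine; remQuot; toℕ; fromℕ<; punchOut)
import Data.Fin as F
import Data.Fin.Properties as FP
open import Data.List using (List; []; _∷_; map; concatMap; filter; length; upTo; allFin; _++_; applyUpTo)
import Data.List.Properties as LP
open import Data.Nat using (ℕ; zero; suc; _+_; _*_; _∸_; _≤_; _<_; s≤s; z≤n; _!; _/_)
import Data.Nat as N
open import Data.Nat.DivMod using (m*n/n≡m)
open import Data.Nat.ListAction using (sum; product)
open import Data.Nat.ListAction.Properties using (sum-++)
open import Data.Nat.Properties
open import Data.Product using (_×_; _,_; proj₁; proj₂; Σ)
open import Data.Sum using (_⊎_; inj₁; inj₂)
open import Data.Vec.Functional using () renaming (_∷_ to _◂_)
open import Function using (_∘_; id)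
open import Relation.Binary.PropositionalEquality
open import Relation.Nullary using (Dec; yes; no; does; ¬_; _×-dec_)
open import Relation.Nullary.Decidable using (dec-true; dec-false; _→-dec_)

+-interchange : ∀ a b c d → (a + b) + (c + d) ≡ (a + c) + (b + d)
+-interchange = interchange +-commutativeSemigroup

*-interchange : ∀ a b c d → (a * b) * (c * d) ≡ (a * c) * (b * d)
*-interchange = interchange *-commutativeSemigroup

*-left-comm : ∀ a b c → a * (b * c) ≡ b * (a * c)
*-left-comm = x∙yz≈y∙xz *-commutativeSemigroup

-- Sums over lists.  Σ[ m ] f of Defs is definitionally sumL (allFin m) f.

private
  variable
    A C : Set

sumL : List A → (A → ℕ) → ℕ
sumL L w = sum (map w L)

sumL-++ : (xs ys : List A) (w : A → ℕ) → sumL (xs ++ ys) w ≡ sumL xs w + sumL ys w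
sumL-++ xs ys w = trans (cong sum (LP.map-++ w xs ys)) (sum-++ (map w xs) (map w ys))

sumL-cong : (L : List A) {w v : A → ℕ} → (∀ x → w x ≡ v x) → sumL L w ≡ sumL L v
sumL-cong L e = cong sum (LP.map-cong e L)

sumL-zero : (L : List A) → sumL L (λ _ → 0) ≡ 0
sumL-zero []      = refl
sumL-zero (x ∷ L) = sumL-zero L

sumL-+ : (L : List A) (w v : A → ℕ) → sumL L (λ x → w x + v x) ≡ sumL L w + sumL L v
sumL-+ []      w v = refl
sumL-+ (x ∷ L) w v =
  trans (cong (w x + v x +_) (sumL-+ L w v)) (+-interchange (w x) (v x) (sumL L w) (sumL L v))

sumL-*ˡ : (L : List A) (c : ℕ) (w : A → ℕ) → sumL L (λ x → c * w x) ≡ c * sumL L w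
sumL-*ˡ []      c w = sym (*-zeroʳ c)
sumL-*ˡ (x ∷ L) c w =
  trans (cong (c * w x +_) (sumL-*ˡ L c w)) (sym (*-distribˡ-+ c (w x) (sumL L w)))

sumL-*ʳ : (L : List A) (c : ℕ) (w : A → ℕ) → sumL L (λ x → w x * c) ≡ sumL L w * c
sumL-*ʳ L c w =
  trans (sumL-cong L (λ x → *-comm (w x) c)) (trans (sumL-*ˡ L c w) (*-comm c (sumL L w)))

sumL-swap : (L : List A) (M : List C) (w : A → C → ℕ) →
  sumL L (λ x → sumL M (w x)) ≡ sumL M (λ y → sumL L (λ x → w x y))
sumL-swap []      M w = sym (sumL-zero M)
sumL-swap (x ∷ L) M w =
  trans (cong (sumL M (w x) +_) (sumL-swap L M w)) (sym (sumL-+ M (w x) (λ y → sumL L (λ x' → w x' y))))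

sumL-mono : (L : List A) {w v : A → ℕ} → (∀ x → w x ≤ v x) → sumL L w ≤ sumL L v
sumL-mono []      h = z≤n
sumL-mono (x ∷ L) h = +-mono-≤ (h x) (sumL-mono L h)

sumL-map : (h : A → C) (L : List A) (w : C → ℕ) → sumL (map h L) w ≡ sumL L (w ∘ h)
sumL-map h L w = cong sum (sym (LP.map-∘ L))

sumL-concatMap : (g : A → List C) (L : List A) (w : C → ℕ) →
  sumL (concatMap g L) w ≡ sumL L (λ x → sumL (g x) w)
sumL-concatMap g []      w = refl
sumL-concatMap g (x ∷ L) w =
  trans (sumL-++ (g x) (concatMap g L) w) (cong (sumL (g x) w +_) (sumL-concatMap g L w))

bit-∧ : ∀ x y → bit (x ∧ y) ≡ bit x * bit y
bit-∧ true  y = sym (+-identityʳ (bit y))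
bit-∧ false y = refl

bit-*-cong : (b : Bool) {u v : ℕ} → (b ≡ true → u ≡ v) → bit b * u ≡ bit b * v
bit-*-cong true  h = cong (1 *_) (h refl)
bit-*-cong false h = refl

bool-ext : {x y : Bool} → (x ≡ true → y ≡ true) → (y ≡ true → x ≡ true) → x ≡ y
bool-ext {true}  {true}  f g = refl
bool-ext {true}  {false} f g = sym (f refl)
bool-ext {false} {true}  f g = g refl
bool-ext {false} {false} f g = refl

true≢false : true ≢ false
true≢false ()

bool-false : {b : Bool} → ¬ (b ≡ true) → b ≡ false
bool-false {true}  h = ⊥-elim (h refl)
bool-false {false} h = refl

∧-true₁ : ∀ {x y} → x ∧ y ≡ true → x ≡ true
∧-true₁ {true} e = refl

∧-true₂ : ∀ {x y} → x ∧ y ≡ true → y ≡ true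
∧-true₂ {true} e = e

∧-intro : ∀ {x y} → x ≡ true → y ≡ true → x ∧ y ≡ true
∧-intro refl refl = refl

does-true : {P : Set} (d : Dec P) → does d ≡ true → P
does-true (yes p) e = p

eqFin : ∀ {m} → Fin m → Fin m → Bool
eqFin i j = does (i F.≟ j)

eqFin-true : ∀ {m} {i j : Fin m} → eqFin i j ≡ true → i ≡ j
eqFin-true {i = i} {j} = does-true (i F.≟ j)

eqFin-intro : ∀ {m} {i j : Fin m} → i ≡ j → eqFin i j ≡ true
eqFin-intro {i = i} {j} = dec-true (i F.≟ j)

eqFin-false : ∀ {m} {i j : Fin m} → ¬ (i ≡ j) → eqFin i j ≡ false
eqFin-false {i = i} {j} = dec-false (i F.≟ j)

eqFin-refl : ∀ {m} (i : Fin m) → eqFin i i ≡ true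
eqFin-refl i = eqFin-intro {i = i} refl

eqFin-suc : ∀ {m} (i j : Fin m) → eqFin (F.suc i) (F.suc j) ≡ eqFin i j
eqFin-suc i j = bool-ext (λ e → eqFin-intro {i = i} (FP.suc-injective (eqFin-true {i = F.suc i} e)))
                         (λ e → eqFin-intro {i = F.suc i} (cong F.suc (eqFin-true {i = i} e)))

allB : ∀ {m} → (Fin m → Bool) → Bool
allB {zero}  P = true
allB {suc m} P = P F.zero ∧ allB (P ∘ F.suc)

allB-true : ∀ {m} (P : Fin m → Bool) → allB P ≡ true → ∀ i → P i ≡ true
allB-true {suc m} P e F.zero    = ∧-true₁ e
allB-true {suc m} P e (F.suc i) = allB-true (P ∘ F.suc) (∧-true₂ {P F.zero} e) i

allB-intro : ∀ {m} (P : Fin m → Bool) → (∀ i → P i ≡ true) → allB P ≡ true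
allB-intro {zero}  P h = refl
allB-intro {suc m} P h = ∧-intro (h F.zero) (allB-intro (P ∘ F.suc) (h ∘ F.suc))

eqF : ∀ {m} → (A → A → Bool) → (Fin m → A) → (Fin m → A) → Bool
eqF e f g = allB (λ i → e (f i) (g i))

eqF-true : ∀ {m} (e : A → A → Bool) {f g : Fin m → A} → eqF e f g ≡ true → ∀ i → e (f i) (g i) ≡ true
eqF-true e {f} {g} = allB-true (λ i → e (f i) (g i))

eqF-intro : ∀ {m} (e : A → A → Bool) {f g : Fin m → A} → (∀ i → e (f i) (g i) ≡ true) → eqF e f g ≡ true
eqF-intro e {f} {g} = allB-intro (λ i → e (f i) (g i))

eqF-≗ : ∀ {m n} {f g : Fin m → Fin n} → eqF eqFin f g ≡ true → f ≗ g
eqF-≗ {f = f} {g} e i = eqFin-true (eqF-true eqFin {f = f} {g} e i)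

≗-eqF : ∀ {m n} {f g : Fin m → Fin n} → f ≗ g → eqF eqFin f g ≡ true
≗-eqF {f = f} {g} e = eqF-intro eqFin {f = f} {g} (λ i → eqFin-intro (e i))

sumL-const-1 : (L : List A) → sumL L (λ _ → 1) ≡ length L
sumL-const-1 []      = refl
sumL-const-1 (x ∷ L) = cong suc (sumL-const-1 L)

sumL-filter : {P : A → Set} (P? : (x : A) → Dec (P x)) (L : List A) (w : A → ℕ) →
  sumL (filter P? L) w ≡ sumL L (λ x → bit (does (P? x)) * w x)
sumL-filter P? []      w = refl
sumL-filter P? (x ∷ L) w with does (P? x)
... | true  = cong₂ _+_ (sym (+-identityʳ (w x))) (sumL-filter P? L w)
... | false = sumL-filter P? L w

sumL-filter-cong : {P : A → Set} (P? : (x : A) → Dec (P x)) (L : List A) {f g : A → ℕ} →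
  (∀ x → P x → f x ≡ g x) → sumL (filter P? L) f ≡ sumL (filter P? L) g
sumL-filter-cong P? L {f} {g} f≡g = trans (sumL-filter P? L f) (trans (sumL-cong L agree) (sym (sumL-filter P? L g)))
  where
  agree : ∀ x → bit (does (P? x)) * f x ≡ bit (does (P? x)) * g x
  agree x = bit-*-cong (does (P? x)) (λ e → f≡g x (does-true (P? x) e))

length-filter : {P : A → Set} (P? : (x : A) → Dec (P x)) (L : List A) →
  length (filter P? L) ≡ sumL L (λ x → bit (does (P? x)))
length-filter P? L = begin
  length (filter P? L)                              ≡⟨ sym (sumL-const-1 (filter P? L)) ⟩
  sumL (filter P? L) (λ _ → 1)                      ≡⟨ sumL-filter P? L (λ _ → 1) ⟩
  sumL L (λ x → bit (does (P? x)) * 1)              ≡⟨ sumL-cong L (λ x → *-identityʳ (bit (does (P? x)))) ⟩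
  sumL L (λ x → bit (does (P? x)))                  ∎
  where open ≡-Reasoning

Σ-suc : ∀ m (f : Fin (suc m) → ℕ) → Σ[ suc m ] f ≡ f F.zero + Σ[ m ] (f ∘ F.suc)
Σ-suc m f = cong (f F.zero +_) (cong sum (trans (LP.map-tabulate F.suc f) (sym (LP.map-tabulate id (f ∘ F.suc)))))

Π-suc : ∀ m (f : Fin (suc m) → ℕ) → Π[ suc m ] f ≡ f F.zero * Π[ m ] (f ∘ F.suc)
Π-suc m f = cong (f F.zero *_) (cong product (trans (LP.map-tabulate F.suc f) (sym (LP.map-tabulate id (f ∘ F.suc)))))

Σ-const-1 : ∀ m → Σ[ m ] (λ _ → 1) ≡ m
Σ-const-1 m = trans (sumL-const-1 (allFin m)) (LP.length-tabulate id)

Π-cong : ∀ m {f g : Fin m → ℕ} → (∀ i → f i ≡ g i) → Π[ m ] f ≡ Π[ m ] g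
Π-cong m e = cong product (LP.map-cong e (allFin m))

summand-≤ : ∀ m (f : Fin m → ℕ) i → f i ≤ Σ[ m ] f
summand-≤ (suc m) f F.zero    = m≤m+n (f F.zero) _
summand-≤ (suc m) f (F.suc i) =
  subst (f (F.suc i) ≤_) (sym (Σ-suc m f)) (≤-trans (summand-≤ m (f ∘ F.suc) i) (m≤n+m _ (f F.zero)))

Π-const-1 : ∀ m → Π[ m ] (λ _ → 1) ≡ 1
Π-const-1 zero    = refl
Π-const-1 (suc m) = trans (Π-suc m (λ _ → 1)) (trans (+-identityʳ _) (Π-const-1 m))

Π-* : ∀ m (f g : Fin m → ℕ) → Π[ m ] (λ i → f i * g i) ≡ Π[ m ] f * Π[ m ] g
Π-* zero    f g = refl
Π-* (suc m) f g = begin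
  Π[ suc m ] (λ i → f i * g i)                                ≡⟨ Π-suc m (λ i → f i * g i) ⟩
  f F.zero * g F.zero * Π[ m ] (λ i → f (F.suc i) * g (F.suc i))
    ≡⟨ cong (f F.zero * g F.zero *_) (Π-* m (f ∘ F.suc) (g ∘ F.suc)) ⟩
  f F.zero * g F.zero * (Π[ m ] (f ∘ F.suc) * Π[ m ] (g ∘ F.suc)) ≡⟨ *-interchange (f F.zero) (g F.zero) _ _ ⟩
  (f F.zero * Π[ m ] (f ∘ F.suc)) * (g F.zero * Π[ m ] (g ∘ F.suc)) ≡⟨ sym (cong₂ _*_ (Π-suc m f) (Π-suc m g)) ⟩
  Π[ suc m ] f * Π[ suc m ] g                                 ∎
  where open ≡-Reasoning

Σ-delta : ∀ m (i₀ : Fin m) (w : Fin m → ℕ) → Σ[ m ] (λ i → bit (eqFin i₀ i) * w i) ≡ w i₀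
Σ-delta (suc m) F.zero w = begin
  Σ[ suc m ] (λ i → bit (eqFin F.zero i) * w i) ≡⟨ Σ-suc m (λ i → bit (eqFin F.zero i) * w i) ⟩
  w F.zero + 0 + Σ[ m ] (λ _ → 0)               ≡⟨ cong₂ _+_ (+-identityʳ (w F.zero)) (sumL-zero (allFin m)) ⟩
  w F.zero + 0                                  ≡⟨ +-identityʳ (w F.zero) ⟩
  w F.zero                                      ∎
  where open ≡-Reasoning
Σ-delta (suc m) (F.suc i₀) w = begin
  Σ[ suc m ] (λ i → bit (eqFin (F.suc i₀) i) * w i) ≡⟨ Σ-suc m (λ i → bit (eqFin (F.suc i₀) i) * w i) ⟩
  Σ[ m ] (λ i → bit (eqFin (F.suc i₀) (F.suc i)) * w (F.suc i))
    ≡⟨ sumL-cong (allFin m) (λ i → cong (λ b → bit b * w (F.suc i)) (eqFin-suc i₀ i)) ⟩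
  Σ[ m ] (λ i → bit (eqFin i₀ i) * w (F.suc i))  ≡⟨ Σ-delta m i₀ (w ∘ F.suc) ⟩
  w (F.suc i₀)                                   ∎
  where open ≡-Reasoning

Σ-delta-1 : ∀ m (i₀ : Fin m) → Σ[ m ] (λ i → bit (eqFin i₀ i)) ≡ 1
Σ-delta-1 m i₀ = trans (sumL-cong (allFin m) (λ i → sym (*-identityʳ (bit (eqFin i₀ i))))) (Σ-delta m i₀ (λ _ → 1))

Π-delta : ∀ m (j₀ : Fin m) (f : Fin m → ℕ) → Π[ m ] (λ j → if eqFin j₀ j then f j else 1) ≡ f j₀
Π-delta (suc m) F.zero f =
  trans (Π-suc m (λ j → if eqFin F.zero j then f j else 1)) (trans (cong (f F.zero *_) (Π-const-1 m)) (*-identityʳ (f F.zero)))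
Π-delta (suc m) (F.suc j₀) f = begin
  Π[ suc m ] (λ j → if eqFin (F.suc j₀) j then f j else 1)
    ≡⟨ Π-suc m (λ j → if eqFin (F.suc j₀) j then f j else 1) ⟩
  1 * Π[ m ] (λ j → if eqFin (F.suc j₀) (F.suc j) then f (F.suc j) else 1) ≡⟨ *-identityˡ _ ⟩
  Π[ m ] (λ j → if eqFin (F.suc j₀) (F.suc j) then f (F.suc j) else 1)
    ≡⟨ Π-cong m (λ j → cong (λ b → if b then f (F.suc j) else 1) (eqFin-suc j₀ j)) ⟩
  Π[ m ] (λ j → if eqFin j₀ j then f (F.suc j) else 1)                     ≡⟨ Π-delta m j₀ (f ∘ F.suc) ⟩
  f (F.suc j₀)                                                             ∎
  where open ≡-Reasoning

Π-split : ∀ m (j₀ : Fin m) (f : Fin m → ℕ) → Π[ m ] f ≡ f j₀ * Π[ m ] (λ j → if eqFin j₀ j then 1 else f j)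
Π-split m j₀ f = begin
  Π[ m ] f                                                                 ≡⟨ Π-cong m factor ⟩
  Π[ m ] (λ j → (if eqFin j₀ j then f j else 1) * (if eqFin j₀ j then 1 else f j)) ≡⟨ Π-* m _ _ ⟩
  Π[ m ] (λ j → if eqFin j₀ j then f j else 1) * Π[ m ] (λ j → if eqFin j₀ j then 1 else f j)
    ≡⟨ cong (_* Π[ m ] (λ j → if eqFin j₀ j then 1 else f j)) (Π-delta m j₀ f) ⟩
  f j₀ * Π[ m ] (λ j → if eqFin j₀ j then 1 else f j)                       ∎
  where
  open ≡-Reasoning
  factor : ∀ j → f j ≡ (if eqFin j₀ j then f j else 1) * (if eqFin j₀ j then 1 else f j)
  factor j with eqFin j₀ j
  ... | true  = sym (*-identityʳ (f j))
  ... | false = sym (+-identityʳ (f j))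

bit-allB : ∀ {m} (P : Fin m → Bool) → bit (allB P) ≡ Π[ m ] (bit ∘ P)
bit-allB {zero}  P = refl
bit-allB {suc m} P = trans (bit-∧ (P F.zero) (allB (P ∘ F.suc)))
  (trans (cong (bit (P F.zero) *_) (bit-allB (P ∘ F.suc))) (sym (Π-suc m (bit ∘ P))))

OccursOnce : (A → A → Bool) → List A → A → Set
OccursOnce eq L y = sumL L (λ x → bit (eq y x)) ≡ 1

Enumerates : (A → A → Bool) → List A → Set
Enumerates eq L = ∀ y → OccursOnce eq L y

allFin-enumerates : ∀ m → Enumerates eqFin (allFin m)
allFin-enumerates = Σ-delta-1

sumL-funcs-suc : ∀ m (L : List A) (w : (Fin (suc m) → A) → ℕ) →
  sumL (funcs (suc m) L) w ≡ sumL L (λ a → sumL (funcs m L) (λ f → w (a ◂ f)))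
sumL-funcs-suc m L w = trans (sumL-concatMap (λ a → map (a ◂_) (funcs m L)) L w)
                             (sumL-cong L (λ a → sumL-map (a ◂_) (funcs m L) w))

funcs-occursOnce : ∀ m {e : A → A → Bool} {L : List A} (f : Fin m → A) →
  (∀ b → OccursOnce e L (f b)) → OccursOnce (eqF e) (funcs m L) f
funcs-occursOnce zero    f once = refl
funcs-occursOnce (suc m) {e} {L} f once = begin
  sumL (funcs (suc m) L) (λ g → bit (eqF e f g)) ≡⟨ sumL-funcs-suc m L _ ⟩
  sumL L (λ a → sumL (funcs m L) (λ g → bit (e (f F.zero) a ∧ eqF e (f ∘ F.suc) g)))
    ≡⟨ sumL-cong L (λ a → trans (sumL-cong (funcs m L) (λ g → bit-∧ (e (f F.zero) a) (eqF e (f ∘ F.suc) g)))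
                                (sumL-*ˡ (funcs m L) (bit (e (f F.zero) a)) _)) ⟩
  sumL L (λ a → bit (e (f F.zero) a) * sumL (funcs m L) (λ g → bit (eqF e (f ∘ F.suc) g)))
    ≡⟨ sumL-cong L (λ a → cong (bit (e (f F.zero) a) *_) (funcs-occursOnce m {e} {L} (f ∘ F.suc) (once ∘ F.suc))) ⟩
  sumL L (λ a → bit (e (f F.zero) a) * 1) ≡⟨ sumL-cong L (λ a → *-identityʳ _) ⟩
  sumL L (λ a → bit (e (f F.zero) a))     ≡⟨ once F.zero ⟩
  1                                       ∎
  where open ≡-Reasoning

funcs-enumerates : ∀ m {e : A → A → Bool} {L : List A} → Enumerates e L → Enumerates (eqF e) (funcs m L)
funcs-enumerates m {e} {L} enum f = funcs-occursOnce m {e} {L} f (enum ∘ f)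

sumL-funcs-Π : ∀ m (L : List A) (w : Fin m → A → ℕ) →
  sumL (funcs m L) (λ g → Π[ m ] (λ i → w i (g i))) ≡ Π[ m ] (λ i → sumL L (w i))
sumL-funcs-Π zero    L w = refl
sumL-funcs-Π (suc m) L w = begin
  sumL (funcs (suc m) L) (λ g → Π[ suc m ] (λ i → w i (g i))) ≡⟨ sumL-funcs-suc m L _ ⟩
  sumL L (λ a → sumL (funcs m L) (λ g → Π[ suc m ] (λ i → w i ((a ◂ g) i))))
    ≡⟨ sumL-cong L (λ a → trans (sumL-cong (funcs m L) (λ g → Π-suc m (λ i → w i ((a ◂ g) i))))
                                (sumL-*ˡ (funcs m L) (w F.zero a) _)) ⟩
  sumL L (λ a → w F.zero a * sumL (funcs m L) (λ g → Π[ m ] (λ i → w (F.suc i) (g i))))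
    ≡⟨ sumL-cong L (λ a → cong (w F.zero a *_) (sumL-funcs-Π m L (w ∘ F.suc))) ⟩
  sumL L (λ a → w F.zero a * Π[ m ] (λ i → sumL L (w (F.suc i)))) ≡⟨ sumL-*ʳ L _ (w F.zero) ⟩
  sumL L (w F.zero) * Π[ m ] (λ i → sumL L (w (F.suc i)))         ≡⟨ sym (Π-suc m (λ i → sumL L (w i))) ⟩
  Π[ suc m ] (λ i → sumL L (w i))                                 ∎
  where open ≡-Reasoning

sumL-funcs-filter : {P : A → Set} (P? : (x : A) → Dec (P x)) → ∀ m (L : List A) (w : (Fin m → A) → ℕ) →
  sumL (funcs m (filter P? L)) w ≡ sumL (funcs m L) (λ f → bit (allB (λ b → does (P? (f b)))) * w f)
sumL-funcs-filter P? zero    L w = sym (+-identityʳ _)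
sumL-funcs-filter P? (suc m) L w = begin
  sumL (funcs (suc m) (filter P? L)) w ≡⟨ sumL-funcs-suc m (filter P? L) w ⟩
  sumL (filter P? L) (λ a → sumL (funcs m (filter P? L)) (λ f → w (a ◂ f))) ≡⟨ sumL-filter P? L _ ⟩
  sumL L (λ a → bit (does (P? a)) * sumL (funcs m (filter P? L)) (λ f → w (a ◂ f)))
    ≡⟨ sumL-cong L (λ a → cong (bit (does (P? a)) *_) (sumL-funcs-filter P? m L (λ f → w (a ◂ f)))) ⟩
  sumL L (λ a → bit (does (P? a)) * sumL (funcs m L) (λ f → good f * w (a ◂ f)))
    ≡⟨ sumL-cong L (λ a → sym (sumL-*ˡ (funcs m L) (bit (does (P? a))) (λ f → good f * w (a ◂ f)))) ⟩
  sumL L (λ a → sumL (funcs m L) (λ f → bit (does (P? a)) * (good f * w (a ◂ f))))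
    ≡⟨ sumL-cong L (λ a → sumL-cong (funcs m L) (λ f → trans (sym (*-assoc (bit (does (P? a))) _ _))
                                                           (cong (_* w (a ◂ f)) (sym (bit-∧ (does (P? a)) _))))) ⟩
  sumL L (λ a → sumL (funcs m L) (λ f → good (a ◂ f) * w (a ◂ f))) ≡⟨ sym (sumL-funcs-suc m L _) ⟩
  sumL (funcs (suc m) L) (λ f → good f * w f)                       ∎
  where
  open ≡-Reasoning
  good : ∀ {k} → (Fin k → _) → ℕ
  good f = bit (allB (λ b → does (P? (f b))))

Extensional : ∀ {m} → ((Fin m → A) → ℕ) → Set
Extensional {m = m} w = ∀ (f g : Fin m → _) → (∀ b → f b ≡ g b) → w f ≡ w g

sumL-funcs-map : (h : A → C) → ∀ m (L : List A) (w : (Fin m → C) → ℕ) → Extensional w →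
  sumL (funcs m (map h L)) w ≡ sumL (funcs m L) (λ f → w (h ∘ f))
sumL-funcs-map h zero    L w ext = cong (_+ 0) (ext _ _ (λ ()))
sumL-funcs-map h (suc m) L w ext = begin
  sumL (funcs (suc m) (map h L)) w ≡⟨ sumL-funcs-suc m (map h L) w ⟩
  sumL (map h L) (λ a → sumL (funcs m (map h L)) (λ f → w (a ◂ f))) ≡⟨ sumL-map h L _ ⟩
  sumL L (λ x → sumL (funcs m (map h L)) (λ f → w (h x ◂ f)))
    ≡⟨ sumL-cong L (λ x → sumL-funcs-map h m L (λ f → w (h x ◂ f))
                            (λ f g e → ext _ _ (λ { F.zero → refl ; (F.suc b) → e b }))) ⟩
  sumL L (λ x → sumL (funcs m L) (λ f → w (h x ◂ (h ∘ f))))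
    ≡⟨ sumL-cong L (λ x → sumL-cong (funcs m L) (λ f → ext _ _ (λ { F.zero → refl ; (F.suc b) → refl }))) ⟩
  sumL L (λ x → sumL (funcs m L) (λ f → w (h ∘ (x ◂ f)))) ≡⟨ sym (sumL-funcs-suc m L _) ⟩
  sumL (funcs (suc m) L) (λ f → w (h ∘ f))                  ∎
  where open ≡-Reasoning

count : List A → (A → Bool) → ℕ
count L P = sumL L (λ x → bit (P x))

count-bijection : {L₁ : List A} {L₂ : List C} {eqA : A → A → Bool} {eqC : C → C → Bool} →
  Enumerates eqA L₁ → Enumerates eqC L₂ →
  (P : A → Bool) (Q : C → Bool) (φ : A → C) (ψ : C → A) →
  (∀ x y → P x ∧ eqC (φ x) y ≡ Q y ∧ eqA (ψ y) x) →
  count L₁ P ≡ count L₂ Q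
count-bijection {L₁ = L₁} {L₂} {eqA} {eqC} enum₁ enum₂ P Q φ ψ graph = begin
  sumL L₁ (λ x → bit (P x))                                      ≡⟨ sumL-cong L₁ (λ x → sym (weigh₂ x)) ⟩
  sumL L₁ (λ x → bit (P x) * sumL L₂ (λ y → bit (eqC (φ x) y)))  ≡⟨ sumL-cong L₁ (λ x → sym (sumL-*ˡ L₂ (bit (P x)) _)) ⟩
  sumL L₁ (λ x → sumL L₂ (λ y → bit (P x) * bit (eqC (φ x) y)))
    ≡⟨ sumL-cong L₁ (λ x → sumL-cong L₂ (λ y → trans (sym (bit-∧ (P x) _)) (trans (cong bit (graph x y)) (bit-∧ (Q y) _)))) ⟩
  sumL L₁ (λ x → sumL L₂ (λ y → bit (Q y) * bit (eqA (ψ y) x)))  ≡⟨ sumL-swap L₁ L₂ _ ⟩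
  sumL L₂ (λ y → sumL L₁ (λ x → bit (Q y) * bit (eqA (ψ y) x)))  ≡⟨ sumL-cong L₂ (λ y → sumL-*ˡ L₁ (bit (Q y)) _) ⟩
  sumL L₂ (λ y → bit (Q y) * sumL L₁ (λ x → bit (eqA (ψ y) x)))  ≡⟨ sumL-cong L₂ weigh₁ ⟩
  sumL L₂ (λ y → bit (Q y))                                      ∎
  where
  open ≡-Reasoning
  weigh₂ : ∀ x → bit (P x) * sumL L₂ (λ y → bit (eqC (φ x) y)) ≡ bit (P x)
  weigh₂ x = trans (cong (bit (P x) *_) (enum₂ (φ x))) (*-identityʳ _)
  weigh₁ : ∀ y → bit (Q y) * sumL L₁ (λ x → bit (eqA (ψ y) x)) ≡ bit (Q y)
  weigh₁ y = trans (cong (bit (Q y) *_) (enum₁ (ψ y))) (*-identityʳ _)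

remove : ∀ {q} → (Fin q → Bool) → Fin q → (Fin q → Bool)
remove S x b = S b ∧ not (eqFin b x)

module _ {q : ℕ} (S : Fin q → Bool) (x : Fin q) where

  remove-self : remove S x x ≡ false
  remove-self rewrite eqFin-refl x = ∧-zeroʳ (S x)

  remove-other : ∀ {b} → ¬ (b ≡ x) → remove S x b ≡ S b
  remove-other {b} b≢x rewrite eqFin-false b≢x = ∧-identityʳ (S b)

  remove-outside : ∀ {b} → S b ≡ false → remove S x b ≡ false
  remove-outside {b} Sb rewrite Sb = refl

  remove-false : ∀ {b} → remove S x b ≡ false → (S b ≡ false) ⊎ (b ≡ x)
  remove-false {b} e = decide (b F.≟ x)
    where
    decide : Dec (b ≡ x) → (S b ≡ false) ⊎ (b ≡ x)
    decide (yes b≡x) = inj₂ b≡x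
    decide (no  b≢x) = inj₁ (trans (sym (remove-other b≢x)) e)

countIn : ∀ {q} → (Fin q → Bool) → (Fin q → Bool) → ℕ
countIn {q} S P = Σ[ q ] (λ b → bit (S b ∧ P b))

countIn-remove : ∀ {q} (S P : Fin q → Bool) (x : Fin q) →
  countIn S P ≡ countIn (remove S x) P + bit (S x ∧ P x)
countIn-remove {q} S P x = begin
  Σ[ q ] (λ b → bit (S b ∧ P b))                                       ≡⟨ sumL-cong (allFin q) split ⟩
  Σ[ q ] (λ b → bit (remove S x b ∧ P b) + bit (eqFin x b) * bit (S x ∧ P x)) ≡⟨ sumL-+ (allFin q) _ _ ⟩
  countIn (remove S x) P + Σ[ q ] (λ b → bit (eqFin x b) * bit (S x ∧ P x))
    ≡⟨ cong (countIn (remove S x) P +_) (Σ-delta q x _) ⟩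
  countIn (remove S x) P + bit (S x ∧ P x)                              ∎
  where
  open ≡-Reasoning
  split : ∀ b → bit (S b ∧ P b) ≡ bit (remove S x b ∧ P b) + bit (eqFin x b) * bit (S x ∧ P x)
  split b with b F.≟ x
  ... | yes refl rewrite eqFin-refl x | ∧-zeroʳ (S x) = sym (+-identityʳ _)
  ... | no b≢x rewrite eqFin-false {i = x} (b≢x ∘ sym) | ∧-identityʳ (S b) = sym (+-identityʳ _)

Inv : ℕ → ℕ
Inv zero          = 1
Inv (suc zero)    = 1
Inv (suc (suc n)) = Inv (suc n) + suc n * Inv n

Inv-suc : ∀ m → Inv (suc m) ≡ Inv m + m * Inv (m ∸ 1)
Inv-suc zero    = refl
Inv-suc (suc m) = refl

-- The proof picks x ∈ S and splits according to g x:
-- either g fixes x, or g swaps x with a point y ∈ S - x of the same colour,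
-- and swapping x, y back identifies such g with the (S - x - y)-involutions.

module ColouredInvolutions {q p : ℕ} (c : Fin q → Fin p) where

  GoodAt : (Fin q → Bool) → (Fin q → Fin q) → Fin q → Set
  GoodAt S g b = (g (g b) ≡ b) × (c (g b) ≡ c b) × (S b ≡ false → g b ≡ b)

  SInvolution : (Fin q → Bool) → (Fin q → Fin q) → Set
  SInvolution S g = ∀ b → GoodAt S g b

  sInvolution? : (Fin q → Bool) → (Fin q → Fin q) → Bool
  sInvolution? S g = does (FP.all? (λ b → (g (g b) F.≟ b) ×-dec (c (g b) F.≟ c b) ×-dec
                                           ((S b B.≟ false) →-dec (g b F.≟ b))))

  sInvolution-true : ∀ S g → sInvolution? S g ≡ true → SInvolution S g
  sInvolution-true S g = does-true (FP.all? _)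

  sInvolution-intro : ∀ S g → SInvolution S g → sInvolution? S g ≡ true
  sInvolution-intro S g = dec-true (FP.all? _)

  fixed-GoodAt : ∀ {S g b} → g b ≡ b → GoodAt S g b
  fixed-GoodAt {g = g} e = trans (cong g e) e , cong c e , λ _ → e

  SInvolution-cong : ∀ {S g h} → g ≗ h → SInvolution S g → SInvolution S h
  SInvolution-cong {g = g} {h} g≗h gS b =
    trans (sym (g≗h (h b))) (trans (cong g (sym (g≗h b))) (proj₁ (gS b))) ,
    trans (cong c (sym (g≗h b))) (proj₁ (proj₂ (gS b))) ,
    λ Sb → trans (sym (g≗h b)) (proj₂ (proj₂ (gS b)) Sb)

  SInvolution-mono : ∀ {S S' g} → (∀ b → S' b ≡ false → S b ≡ false) → SInvolution S g → SInvolution S' g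
  SInvolution-mono S'⊆S gS b = proj₁ (gS b) , proj₁ (proj₂ (gS b)) , λ S'b → proj₂ (proj₂ (gS b)) (S'⊆S b S'b)

  outside-fixed : ∀ {S g x} → SInvolution S g → S x ≡ false → g x ≡ x
  outside-fixed gS Sx = proj₂ (proj₂ (gS _)) Sx

  G : List (Fin q → Fin q)
  G = funcs q (allFin q)

  G-enumerates : Enumerates (eqF eqFin) G
  G-enumerates = funcs-enumerates q (allFin-enumerates q)

  #SInv : (Fin q → Bool) → ℕ
  #SInv S = count G (sInvolution? S)

  #SInv-empty : ∀ S → (∀ b → S b ≡ false) → #SInv S ≡ 1
  #SInv-empty S empty = trans (sumL-cong G (λ g → cong bit (bool-ext (to g) (from g)))) (G-enumerates id)
    where
    to : ∀ g → sInvolution? S g ≡ true → eqF eqFin id g ≡ true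
    to g e = ≗-eqF (λ b → sym (outside-fixed (sInvolution-true S g e) (empty b)))
    from : ∀ g → eqF eqFin id g ≡ true → sInvolution? S g ≡ true
    from g e = sInvolution-intro S g (λ b → fixed-GoodAt {S} {g} (sym (eqF-≗ {f = id} {g} e b)))

  #SInvTo : (Fin q → Bool) → Fin q → Fin q → ℕ
  #SInvTo S x y = count G (λ g → eqFin (g x) y ∧ sInvolution? S g)

  #SInv-split : ∀ S x → #SInv S ≡ Σ[ q ] (#SInvTo S x)
  #SInv-split S x = begin
    sumL G (λ g → bit (sInvolution? S g))
      ≡⟨ sumL-cong G (λ g → sym (trans (cong (_* bit (sInvolution? S g)) (Σ-delta-1 q (g x))) (+-identityʳ _))) ⟩
    sumL G (λ g → Σ[ q ] (λ y → bit (eqFin (g x) y)) * bit (sInvolution? S g))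
      ≡⟨ sumL-cong G (λ g → sym (sumL-*ʳ (allFin q) (bit (sInvolution? S g)) _)) ⟩
    sumL G (λ g → Σ[ q ] (λ y → bit (eqFin (g x) y) * bit (sInvolution? S g)))
      ≡⟨ sumL-cong G (λ g → sumL-cong (allFin q) (λ y → sym (bit-∧ (eqFin (g x) y) (sInvolution? S g)))) ⟩
    sumL G (λ g → Σ[ q ] (λ y → bit (eqFin (g x) y ∧ sInvolution? S g))) ≡⟨ sumL-swap G (allFin q) _ ⟩
    Σ[ q ] (#SInvTo S x)                                                  ∎
    where open ≡-Reasoning

  #SInvTo-self : ∀ S x → #SInvTo S x x ≡ #SInv (remove S x)
  #SInvTo-self S x = sumL-cong G (λ g → cong bit (bool-ext (to g) (from g)))
    where
    to : ∀ g → eqFin (g x) x ∧ sInvolution? S g ≡ true → sInvolution? (remove S x) g ≡ true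
    to g e = sInvolution-intro (remove S x) g Good
      where
      gS : SInvolution S g
      gS = sInvolution-true S g (∧-true₂ {eqFin (g x) x} e)
      Good : SInvolution (remove S x) g
      Good b = proj₁ (gS b) , proj₁ (proj₂ (gS b)) , fixes
        where
        fixes : remove S x b ≡ false → g b ≡ b
        fixes out with remove-false S x out
        ... | inj₁ Sb   = outside-fixed gS Sb
        ... | inj₂ refl = eqFin-true (∧-true₁ e)
    from : ∀ g → sInvolution? (remove S x) g ≡ true → eqFin (g x) x ∧ sInvolution? S g ≡ true
    from g e = ∧-intro (eqFin-intro (outside-fixed gS (remove-self S x)))
                       (sInvolution-intro S g (SInvolution-mono (λ b → remove-outside S x) gS))
      where
      gS : SInvolution (remove S x) g
      gS = sInvolution-true (remove S x) g e

  partner : (Fin q → Bool) → Fin q → Fin q → Bool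
  partner S x y = remove S x y ∧ eqFin (c y) (c x)

  #SInvTo-none : ∀ S x y → ¬ (y ≡ x) → partner S x y ≡ false → #SInvTo S x y ≡ 0
  #SInvTo-none S x y y≢x no-partner =
    trans (sumL-cong G (λ g → cong bit (bool-false (impossible g)))) (sumL-zero G)
    where
    impossible : ∀ g → ¬ (eqFin (g x) y ∧ sInvolution? S g ≡ true)
    impossible g e = by-membership (S y B.≟ true)
      where
      gx : g x ≡ y
      gx = eqFin-true (∧-true₁ e)
      gS : SInvolution S g
      gS = sInvolution-true S g (∧-true₂ {eqFin (g x) y} e)
      by-membership : Dec (S y ≡ true) → ⊥
      -- y ∈ S: then y would be a partner, since c y = c (g x) = c x.
      by-membership (yes Sy) = true≢false (trans (sym is-partner) no-partner)
        where
        is-partner : partner S x y ≡ true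
        is-partner = ∧-intro (trans (remove-other S x y≢x) Sy)
                             (eqFin-intro (trans (cong c (sym gx)) (proj₁ (proj₂ (gS x)))))
      -- y ∉ S: then g fixes y, so x = g (g x) = g y = y.
      by-membership (no ¬Sy) = y≢x (trans (sym (outside-fixed gS (bool-false ¬Sy))) (trans (cong g (sym gx)) (proj₁ (gS x))))

  -- Given a partner y of x, the S-involutions sending x to y correspond to the
  -- (S - x - y)-involutions: fix x and y, or conversely swap them.
  module Partner (S : Fin q → Bool) (x y : Fin q) (y≢x : ¬ (y ≡ x))
                 (Sx : S x ≡ true) (Sy : S y ≡ true) (cy≡cx : c y ≡ c x) where

    S⁻ : Fin q → Bool
    S⁻ = remove (remove S x) y

    S⁻x : S⁻ x ≡ false
    S⁻x = remove-outside (remove S x) y (remove-self S x)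

    S⁻y : S⁻ y ≡ false
    S⁻y = remove-self (remove S x) y

    S⁻-other : ∀ {b} → ¬ (b ≡ x) → ¬ (b ≡ y) → S⁻ b ≡ S b
    S⁻-other b≢x b≢y = trans (remove-other (remove S x) y b≢y) (remove-other S x b≢x)

    data Position (b : Fin q) : Set where
      at-x  : b ≡ x → Position b
      at-y  : b ≡ y → Position b
      other : ¬ (b ≡ x) → ¬ (b ≡ y) → Position b

    position : ∀ b → Position b
    position b with b F.≟ x | b F.≟ y
    ... | yes b≡x | _       = at-x b≡x
    ... | no  b≢x | yes b≡y = at-y b≡y
    ... | no  b≢x | no  b≢y = other b≢x b≢y

    swap : (Fin q → Fin q) → (Fin q → Fin q)
    swap h b = if eqFin b x then y else if eqFin b y then x else h b

    fix : (Fin q → Fin q) → (Fin q → Fin q)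
    fix g b = if eqFin b x ∨ eqFin b y then b else g b

    swap-x : ∀ h → swap h x ≡ y
    swap-x h rewrite eqFin-refl x = refl

    swap-y : ∀ h → swap h y ≡ x
    swap-y h rewrite eqFin-false y≢x | eqFin-refl y = refl

    swap-other : ∀ h {b} → ¬ (b ≡ x) → ¬ (b ≡ y) → swap h b ≡ h b
    swap-other h b≢x b≢y rewrite eqFin-false b≢x | eqFin-false b≢y = refl

    fix-x : ∀ g → fix g x ≡ x
    fix-x g rewrite eqFin-refl x = refl

    fix-y : ∀ g → fix g y ≡ y
    fix-y g rewrite eqFin-refl y | eqFin-false y≢x = refl

    fix-other : ∀ g {b} → ¬ (b ≡ x) → ¬ (b ≡ y) → fix g b ≡ g b
    fix-other g b≢x b≢y rewrite eqFin-false b≢x | eqFin-false b≢y = refl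

    swap-cong : ∀ {h h'} → h ≗ h' → swap h ≗ swap h'
    swap-cong e b = cong (λ z → if eqFin b x then y else if eqFin b y then x else z) (e b)

    fix-cong : ∀ {g g'} → g ≗ g' → fix g ≗ fix g'
    fix-cong e b = cong (λ z → if eqFin b x ∨ eqFin b y then b else z) (e b)

    avoids : ∀ {g : Fin q → Fin q} {u v : Fin q} → (∀ b → g (g b) ≡ b) → g u ≡ v → ∀ {b} → ¬ (b ≡ u) → ¬ (g b ≡ v)
    avoids {g} inv gu b≢u gb≡v = b≢u (trans (sym (inv _)) (trans (cong g gb≡v) (trans (cong g (sym gu)) (inv _))))

    fix-good : ∀ g → SInvolution S g → g x ≡ y → SInvolution S⁻ (fix g)
    fix-good g gS gx b with position b
    ... | at-x refl = fixed-GoodAt {S⁻} {fix g} (fix-x g)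
    ... | at-y refl = fixed-GoodAt {S⁻} {fix g} (fix-y g)
    ... | other b≢x b≢y =
      trans (cong (fix g) fgb) (trans (fix-other g (avoids inv gy b≢y) (avoids inv gx b≢x)) (inv b)) ,
      trans (cong c fgb) (proj₁ (proj₂ (gS b))) ,
      λ S⁻b → trans fgb (outside-fixed gS (trans (sym (S⁻-other b≢x b≢y)) S⁻b))
      where
      inv : ∀ b → g (g b) ≡ b
      inv b = proj₁ (gS b)
      gy : g y ≡ x
      gy = trans (cong g (sym gx)) (inv x)
      fgb : fix g b ≡ g b
      fgb = fix-other g b≢x b≢y

    swap-good : ∀ h → SInvolution S⁻ h → SInvolution S (swap h)
    swap-good h hS b with position b
    ... | at-x refl = trans (cong (swap h) (swap-x h)) (swap-y h) ,
                      trans (cong c (swap-x h)) cy≡cx ,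
                      λ Sb → ⊥-elim (true≢false (trans (sym Sx) Sb))
    ... | at-y refl = trans (cong (swap h) (swap-y h)) (swap-x h) ,
                      trans (cong c (swap-y h)) (sym cy≡cx) ,
                      λ Sb → ⊥-elim (true≢false (trans (sym Sy) Sb))
    ... | other b≢x b≢y =
      trans (cong (swap h) shb) (trans (swap-other h (avoids inv hx b≢x) (avoids inv hy b≢y)) (inv b)) ,
      trans (cong c shb) (proj₁ (proj₂ (hS b))) ,
      λ Sb → trans shb (outside-fixed hS (trans (S⁻-other b≢x b≢y) Sb))
      where
      inv : ∀ b → h (h b) ≡ b
      inv b = proj₁ (hS b)
      hx : h x ≡ x
      hx = outside-fixed hS S⁻x
      hy : h y ≡ y
      hy = outside-fixed hS S⁻y
      shb : swap h b ≡ h b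
      shb = swap-other h b≢x b≢y

    fix-swap : ∀ h → SInvolution S⁻ h → fix (swap h) ≗ h
    fix-swap h hS b with position b
    ... | at-x refl = trans (fix-x (swap h)) (sym (outside-fixed hS S⁻x))
    ... | at-y refl = trans (fix-y (swap h)) (sym (outside-fixed hS S⁻y))
    ... | other b≢x b≢y = trans (fix-other (swap h) b≢x b≢y) (swap-other h b≢x b≢y)

    swap-fix : ∀ g → SInvolution S g → g x ≡ y → swap (fix g) ≗ g
    swap-fix g gS gx b with position b
    ... | at-x refl = trans (swap-x (fix g)) (sym gx)
    ... | at-y refl = trans (swap-y (fix g)) (sym (trans (cong g (sym gx)) (proj₁ (gS x))))
    ... | other b≢x b≢y = trans (swap-other (fix g) b≢x b≢y) (fix-other g b≢x b≢y)

    #SInvTo-partner : #SInvTo S x y ≡ #SInv S⁻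
    #SInvTo-partner = count-bijection {L₁ = G} {G} {eqF eqFin} {eqF eqFin} G-enumerates G-enumerates
                        (λ g → eqFin (g x) y ∧ sInvolution? S g) (sInvolution? S⁻) fix swap
                        (λ g h → bool-ext (to g h) (from g h))
      where
      to : ∀ g h → (eqFin (g x) y ∧ sInvolution? S g) ∧ eqF eqFin (fix g) h ≡ true →
           sInvolution? S⁻ h ∧ eqF eqFin (swap h) g ≡ true
      to g h e = ∧-intro (sInvolution-intro S⁻ h (SInvolution-cong fg≗h (fix-good g gS gx)))
                         (≗-eqF (λ b → trans (swap-cong (sym ∘ fg≗h) b) (swap-fix g gS gx b)))
        where
        gx∧gS : eqFin (g x) y ∧ sInvolution? S g ≡ true
        gx∧gS = ∧-true₁ e
        gx : g x ≡ y
        gx = eqFin-true (∧-true₁ gx∧gS)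
        gS : SInvolution S g
        gS = sInvolution-true S g (∧-true₂ {eqFin (g x) y} gx∧gS)
        fg≗h : fix g ≗ h
        fg≗h = eqF-≗ (∧-true₂ {eqFin (g x) y ∧ sInvolution? S g} e)
      from : ∀ g h → sInvolution? S⁻ h ∧ eqF eqFin (swap h) g ≡ true →
             (eqFin (g x) y ∧ sInvolution? S g) ∧ eqF eqFin (fix g) h ≡ true
      from g h e = ∧-intro (∧-intro (eqFin-intro (trans (sym (sh≗g x)) (swap-x h)))
                                    (sInvolution-intro S g (SInvolution-cong sh≗g (swap-good h hS))))
                           (≗-eqF (λ b → trans (fix-cong (sym ∘ sh≗g) b) (fix-swap h hS b)))
        where
        hS : SInvolution S⁻ h
        hS = sInvolution-true S⁻ h (∧-true₁ e)
        sh≗g : swap h ≗ g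
        sh≗g = eqF-≗ (∧-true₂ {sInvolution? S⁻ h} e)

  size : (Fin q → Bool) → ℕ
  size S = countIn S (λ _ → true)

  colourCount : (Fin q → Bool) → Fin p → ℕ
  colourCount S j = countIn S (λ b → eqFin (c b) j)

  weight : (Fin q → Bool) → ℕ
  weight S = Π[ p ] (λ j → Inv (colourCount S j))

  othersWeight : (Fin q → Bool) → Fin p → ℕ
  othersWeight S k = Π[ p ] (λ j → if eqFin k j then 1 else Inv (colourCount S j))

  weight-split : ∀ S k → weight S ≡ Inv (colourCount S k) * othersWeight S k
  weight-split S k = Π-split p k (λ j → Inv (colourCount S j))

  size-remove : ∀ S x → S x ≡ true → size S ≡ suc (size (remove S x))
  size-remove S x Sx = trans (countIn-remove S _ x) (trans (cong (λ b → size (remove S x) + bit (b ∧ true)) Sx) (+-comm _ 1))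

  size-remove-≤ : ∀ S x → size (remove S x) ≤ size S
  size-remove-≤ S x = subst (size (remove S x) ≤_) (sym (countIn-remove S _ x)) (m≤m+n _ _)

  weight-empty : ∀ S → (∀ b → S b ≡ false) → weight S ≡ 1
  weight-empty S empty = trans (Π-cong p (λ j → cong Inv (no-points j))) (Π-const-1 p)
    where
    no-points : ∀ j → colourCount S j ≡ 0
    no-points j = trans (sumL-cong (allFin q) (λ b → cong (λ s → bit (s ∧ eqFin (c b) j)) (empty b))) (sumL-zero (allFin q))

  colourCount-remove-same : ∀ S y k → S y ≡ true → c y ≡ k → colourCount S k ≡ suc (colourCount (remove S y) k)
  colourCount-remove-same S y k Sy refl = trans (countIn-remove S _ y)
    (trans (cong₂ (λ a b → colourCount (remove S y) (c y) + bit (a ∧ b)) Sy (eqFin-refl (c y))) (+-comm _ 1))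

  colourCount-remove-other : ∀ S y j → ¬ (c y ≡ j) → colourCount S j ≡ colourCount (remove S y) j
  colourCount-remove-other S y j cy≢j = begin
    colourCount S j                                  ≡⟨ countIn-remove S _ y ⟩
    colourCount (remove S y) j + bit (S y ∧ eqFin (c y) j)
      ≡⟨ cong (λ b → colourCount (remove S y) j + bit (S y ∧ b)) (eqFin-false cy≢j) ⟩
    colourCount (remove S y) j + bit (S y ∧ false)   ≡⟨ cong (λ b → colourCount (remove S y) j + bit b) (∧-zeroʳ (S y)) ⟩
    colourCount (remove S y) j + 0                   ≡⟨ +-identityʳ _ ⟩
    colourCount (remove S y) j                       ∎
    where open ≡-Reasoning

  othersWeight-remove : ∀ S y k → c y ≡ k → othersWeight (remove S y) k ≡ othersWeight S k
  othersWeight-remove S y k refl = Π-cong p factor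
    where
    factor : ∀ j → (if eqFin (c y) j then 1 else Inv (colourCount (remove S y) j))
                 ≡ (if eqFin (c y) j then 1 else Inv (colourCount S j))
    factor j with c y F.≟ j
    ... | yes _    = refl
    ... | no cy≢j = cong Inv (sym (colourCount-remove-other S y j cy≢j))

  #SInvTo-formula : ∀ S x → S x ≡ true → ∀ y →
    #SInvTo S x y ≡ bit (eqFin x y) * #SInv (remove S x) + bit (partner S x y) * #SInv (remove (remove S x) y)
  #SInvTo-formula S x Sx y = decide (y F.≟ x)
    where
    #fixing #swapping : ℕ
    #fixing   = #SInv (remove S x)
    #swapping = #SInv (remove (remove S x) y)
    by-partner : ∀ b → partner S x y ≡ b → ¬ (y ≡ x) → #SInvTo S x y ≡ bit b * #swapping
    by-partner true  is-partner y≢x = trans (Partner.#SInvTo-partner S x y y≢x Sx Sy cy≡cx) (sym (+-identityʳ _))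
      where
      Sy : S y ≡ true
      Sy = trans (sym (remove-other S x y≢x)) (∧-true₁ is-partner)
      cy≡cx : c y ≡ c x
      cy≡cx = eqFin-true (∧-true₂ {remove S x y} is-partner)
    by-partner false no-partner y≢x = #SInvTo-none S x y y≢x no-partner
    decide : Dec (y ≡ x) → #SInvTo S x y ≡ bit (eqFin x y) * #fixing + bit (partner S x y) * #swapping
    decide (yes refl) = trans (#SInvTo-self S x) (sym (begin
      bit (eqFin x x) * #fixing + bit (partner S x x) * #swapping
        ≡⟨ cong₂ (λ b b' → bit b * #fixing + bit (b' ∧ eqFin (c x) (c x)) * #swapping) (eqFin-refl x) (remove-self S x) ⟩
      (#fixing + 0) + 0 ≡⟨ trans (+-identityʳ _) (+-identityʳ _) ⟩
      #fixing           ∎))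
      where open ≡-Reasoning
    decide (no y≢x) = trans (by-partner (partner S x y) refl y≢x)
      (cong (λ b → bit b * #fixing + bit (partner S x y) * #swapping) (sym (eqFin-false {i = x} (y≢x ∘ sym))))

  #SInv-step : ∀ S x → S x ≡ true →
    #SInv (remove S x) ≡ weight (remove S x) →
    (∀ y → partner S x y ≡ true → #SInv (remove (remove S x) y) ≡ weight (remove (remove S x) y)) →
    #SInv S ≡ weight S
  #SInv-step S x Sx ih-fixed ih-swapped = begin
    #SInv S                                            ≡⟨ #SInv-split S x ⟩
    Σ[ q ] (#SInvTo S x)                               ≡⟨ sumL-cong (allFin q) (#SInvTo-formula S x Sx) ⟩
    Σ[ q ] (λ y → bit (eqFin x y) * #SInv S' + bit (partner S x y) * #SInv (remove S' y)) ≡⟨ sumL-+ (allFin q) _ _ ⟩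
    Σ[ q ] (λ y → bit (eqFin x y) * #SInv S') + Σ[ q ] (λ y → bit (partner S x y) * #SInv (remove S' y))
      ≡⟨ cong₂ _+_ (trans (Σ-delta q x _) ih-fixed) (sumL-cong (allFin q) swapped) ⟩
    weight S' + Σ[ q ] (λ y → bit (partner S x y) * (Inv (m ∸ 1) * O))
      ≡⟨ cong₂ _+_ weight-fixed (sumL-*ʳ (allFin q) _ (λ y → bit (partner S x y))) ⟩
    Inv m * O + m * (Inv (m ∸ 1) * O)                  ≡⟨ cong (Inv m * O +_) (sym (*-assoc m _ O)) ⟩
    Inv m * O + m * Inv (m ∸ 1) * O                    ≡⟨ sym (*-distribʳ-+ O (Inv m) _) ⟩
    (Inv m + m * Inv (m ∸ 1)) * O                      ≡⟨ cong (_* O) (sym (Inv-suc m)) ⟩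
    Inv (suc m) * O                                    ≡⟨ cong (λ n → Inv n * O) (sym (colourCount-remove-same S x (c x) Sx refl)) ⟩
    Inv (colourCount S (c x)) * O                      ≡⟨ sym (weight-split S (c x)) ⟩
    weight S                                           ∎
    where
    open ≡-Reasoning
    S' : Fin q → Bool
    S' = remove S x
    -- m other points of S share the colour of x; O is the weight of the other colours.
    m O : ℕ
    m = colourCount S' (c x)
    O = othersWeight S (c x)
    weight-fixed : weight S' ≡ Inv m * O
    weight-fixed = trans (weight-split S' (c x)) (cong (Inv m *_) (othersWeight-remove S x (c x) refl))
    weight-swapped : ∀ y → partner S x y ≡ true → weight (remove S' y) ≡ Inv (m ∸ 1) * O
    weight-swapped y is-partner = begin
      weight (remove S' y)                                   ≡⟨ weight-split (remove S' y) (c x) ⟩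
      Inv (colourCount (remove S' y) (c x)) * othersWeight (remove S' y) (c x)
        ≡⟨ cong₂ (λ n w → Inv n * w)
                 (cong (_∸ 1) (sym (colourCount-remove-same S' y (c x) (∧-true₁ is-partner) cy≡cx)))
                 (trans (othersWeight-remove S' y (c x) cy≡cx) (othersWeight-remove S x (c x) refl)) ⟩
      Inv (m ∸ 1) * O                                        ∎
      where
      cy≡cx : c y ≡ c x
      cy≡cx = eqFin-true (∧-true₂ {S' y} is-partner)
    swapped : ∀ y → bit (partner S x y) * #SInv (remove S' y) ≡ bit (partner S x y) * (Inv (m ∸ 1) * O)
    swapped y = bit-*-cong (partner S x y) (λ is-partner → trans (ih-swapped y is-partner) (weight-swapped y is-partner))

  #SInv-bounded : ∀ k S → size S ≤ k → #SInv S ≡ weight S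
  #SInv-bounded k S size≤k with FP.any? (λ x → S x B.≟ true)
  ... | no none = trans (#SInv-empty S empty) (sym (weight-empty S empty))
    where
    empty : ∀ b → S b ≡ false
    empty b = bool-false (λ Sb → none (b , Sb))
  #SInv-bounded zero    S size≤0 | yes (x , Sx) with () ← subst (_≤ 0) (size-remove S x Sx) size≤0
  #SInv-bounded (suc k) S size≤k | yes (x , Sx) = #SInv-step S x Sx
      (#SInv-bounded k (remove S x) size'≤k)
      (λ y _ → #SInv-bounded k (remove (remove S x) y) (≤-trans (size-remove-≤ (remove S x) y) size'≤k))
    where
    size'≤k : size (remove S x) ≤ k
    size'≤k = ≤-pred (subst (_≤ suc k) (size-remove S x Sx) size≤k)

  #SInv≡weight : ∀ S → #SInv S ≡ weight S
  #SInv≡weight S = #SInv-bounded (size S) S ≤-refl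

#colour-preserving-involutions : ∀ {q p} (c : Fin q → Fin p) →
  count (funcs q (allFin q)) (ColouredInvolutions.sInvolution? c (λ _ → true))
    ≡ Π[ p ] (λ j → Inv (Σ[ q ] (λ b → bit (eqFin (c b) j))))
#colour-preserving-involutions c = ColouredInvolutions.#SInv≡weight c (λ _ → true)

-- With a single colour: the involution numbers I of the statement satisfy the recurrence of Inv.
I≡Inv : ∀ r → I r ≡ Inv r
I≡Inv r = begin
  I r                                                      ≡⟨ length-filter isInvolution? (funcs r (allFin r)) ⟩
  count (funcs r (allFin r)) (does ∘ isInvolution?)        ≡⟨ sumL-cong (funcs r (allFin r)) (λ g → cong bit (bool-ext (to g) (from g))) ⟩
  count (funcs r (allFin r)) (sInvolution? (λ _ → true))   ≡⟨ #colour-preserving-involutions one-colour ⟩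
  Inv (Σ[ r ] (λ _ → 1)) * 1                               ≡⟨ *-identityʳ _ ⟩
  Inv (Σ[ r ] (λ _ → 1))                                   ≡⟨ cong Inv (Σ-const-1 r) ⟩
  Inv r                                                    ∎
  where
  open ≡-Reasoning
  one-colour : Fin r → Fin 1
  one-colour _ = F.zero
  open ColouredInvolutions one-colour using (sInvolution?; sInvolution-true; sInvolution-intro)
  to : ∀ g → does (isInvolution? g) ≡ true → sInvolution? (λ _ → true) g ≡ true
  to g e = sInvolution-intro _ g (λ b → does-true (isInvolution? g) e b , refl , λ ())
  from : ∀ g → sInvolution? (λ _ → true) g ≡ true → does (isInvolution? g) ≡ true
  from g e = dec-true (isInvolution? g) (λ b → proj₁ (sInvolution-true _ g e b))

eqℕ : ℕ → ℕ → Bool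
eqℕ m n = does (m N.≟ n)

eqℕ-true : ∀ {m n} → eqℕ m n ≡ true → m ≡ n
eqℕ-true {m} {n} = does-true (m N.≟ n)

eqℕ-intro : ∀ {m n} → m ≡ n → eqℕ m n ≡ true
eqℕ-intro {m} {n} = dec-true (m N.≟ n)

occurrences : ∀ {q M} → (Fin q → Fin M) → Fin M → ℕ
occurrences {q} k y = Σ[ q ] (λ b → bit (eqFin (k b) y))

occurrences-cons : ∀ {q M} (x : Fin M) (k : Fin q → Fin M) y →
  occurrences (x ◂ k) y ≡ bit (eqFin x y) + occurrences k y
occurrences-cons {q} x k y = Σ-suc q (λ b → bit (eqFin ((x ◂ k) b) y))

occurrences-total : ∀ {q M} (k : Fin q → Fin M) → Σ[ M ] (occurrences k) ≡ q
occurrences-total {q} {M} k = begin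
  Σ[ M ] (λ y → Σ[ q ] (λ b → bit (eqFin (k b) y))) ≡⟨ sumL-swap (allFin M) (allFin q) _ ⟩
  Σ[ q ] (λ b → Σ[ M ] (λ y → bit (eqFin (k b) y))) ≡⟨ sumL-cong (allFin q) (λ b → Σ-delta-1 M (k b)) ⟩
  Σ[ q ] (λ _ → 1)                                    ≡⟨ Σ-const-1 q ⟩
  q                                                   ∎
  where open ≡-Reasoning

occurrences-≤ : ∀ {q M} (k : Fin q → Fin M) y → occurrences k y ≤ q
occurrences-≤ {q} k y =
  subst (occurrences k y ≤_) (Σ-const-1 q) (sumL-mono (allFin q) (λ b → bit≤1 (eqFin (k b) y)))
  where
  bit≤1 : ∀ b → bit b ≤ 1
  bit≤1 true  = s≤s z≤n
  bit≤1 false = z≤n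

#words : ∀ q M → (Fin M → ℕ) → ℕ
#words q M a = count (funcs q (allFin M)) (λ k → eqF eqℕ (occurrences k) a)

positive : ℕ → Bool
positive zero    = false
positive (suc _) = true

lower : ∀ {M} → (Fin M → ℕ) → Fin M → Fin M → ℕ
lower a x y = a y ∸ bit (eqFin x y)

lower-≤ : ∀ {M} (a : Fin M → ℕ) x y → positive (a x) ≡ true → bit (eqFin x y) ≤ a y
lower-≤ a x y pos with x F.≟ y
... | no _    = z≤n
... | yes refl with a x
...   | suc _ = s≤s z≤n

occurrences-cons-≡ : ∀ {q M} (a : Fin M → ℕ) (x : Fin M) (k : Fin q → Fin M) →
  eqF eqℕ (occurrences (x ◂ k)) a ≡ positive (a x) ∧ eqF eqℕ (occurrences k) (lower a x)
occurrences-cons-≡ {q} {M} a x k = bool-ext to from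
  where
  to : eqF eqℕ (occurrences (x ◂ k)) a ≡ true → positive (a x) ∧ eqF eqℕ (occurrences k) (lower a x) ≡ true
  to e = ∧-intro pos (eqF-intro eqℕ {f = occurrences k} {lower a x} (λ y → eqℕ-intro (begin
      occurrences k y                                      ≡⟨ sym (m+n∸m≡n (bit (eqFin x y)) _) ⟩
      bit (eqFin x y) + occurrences k y ∸ bit (eqFin x y)  ≡⟨ cong (_∸ bit (eqFin x y)) (sym (occurrences-cons x k y)) ⟩
      occurrences (x ◂ k) y ∸ bit (eqFin x y)              ≡⟨ cong (_∸ bit (eqFin x y)) (occ y) ⟩
      lower a x y                                          ∎)))
    where
    open ≡-Reasoning
    occ : ∀ y → occurrences (x ◂ k) y ≡ a y
    occ y = eqℕ-true (eqF-true eqℕ {f = occurrences (x ◂ k)} {a} e y)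
    a-x : a x ≡ suc (occurrences k x)
    a-x = trans (sym (occ x)) (trans (occurrences-cons x k x) (cong (λ b → bit b + occurrences k x) (eqFin-refl x)))
    pos : positive (a x) ≡ true
    pos rewrite a-x = refl
  from : positive (a x) ∧ eqF eqℕ (occurrences k) (lower a x) ≡ true → eqF eqℕ (occurrences (x ◂ k)) a ≡ true
  from e = eqF-intro eqℕ {f = occurrences (x ◂ k)} {a} (λ y → eqℕ-intro (begin
      occurrences (x ◂ k) y                ≡⟨ occurrences-cons x k y ⟩
      bit (eqFin x y) + occurrences k y    ≡⟨ cong (bit (eqFin x y) +_) (occ y) ⟩
      bit (eqFin x y) + lower a x y        ≡⟨ m+[n∸m]≡n (lower-≤ a x y (∧-true₁ e)) ⟩
      a y                                  ∎))
    where
    open ≡-Reasoning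
    occ : ∀ y → occurrences k y ≡ lower a x y
    occ y = eqℕ-true (eqF-true eqℕ {f = occurrences k} {lower a x} (∧-true₂ {positive (a x)} e) y)

Σ-lower : ∀ {M} (a : Fin M → ℕ) x → positive (a x) ≡ true → Σ[ M ] a ≡ suc (Σ[ M ] (lower a x))
Σ-lower {M} a x pos = begin
  Σ[ M ] a                                                ≡⟨ sumL-cong (allFin M) (λ y → sym (m∸n+n≡m (lower-≤ a x y pos))) ⟩
  Σ[ M ] (λ y → lower a x y + bit (eqFin x y))            ≡⟨ sumL-+ (allFin M) _ _ ⟩
  Σ[ M ] (lower a x) + Σ[ M ] (λ y → bit (eqFin x y))     ≡⟨ cong (Σ[ M ] (lower a x) +_) (Σ-delta-1 M x) ⟩
  Σ[ M ] (lower a x) + 1                                  ≡⟨ +-comm _ 1 ⟩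
  suc (Σ[ M ] (lower a x))                                ∎
  where open ≡-Reasoning

prodFact-lower : ∀ {M} (a : Fin M → ℕ) x t → a x ≡ suc t → prodFact a ≡ suc t * prodFact (lower a x)
prodFact-lower {M} a x t a-x = begin
  prodFact a                                  ≡⟨ Π-split M x (λ y → a y !) ⟩
  a x ! * rest a                              ≡⟨ cong (λ n → n ! * rest a) a-x ⟩
  suc t * t ! * rest a                        ≡⟨ *-assoc (suc t) (t !) (rest a) ⟩
  suc t * (t ! * rest a)                      ≡⟨ cong₂ (λ n r → suc t * (n ! * r)) (sym lower-x) (Π-cong M same-rest) ⟩
  suc t * (lower a x x ! * rest (lower a x))  ≡⟨ cong (suc t *_) (sym (Π-split M x (λ y → lower a x y !))) ⟩
  suc t * prodFact (lower a x)                ∎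
  where
  open ≡-Reasoning
  rest : (Fin M → ℕ) → ℕ
  rest b = Π[ M ] (λ y → if eqFin x y then 1 else b y !)
  lower-x : lower a x x ≡ t
  lower-x = trans (cong (λ b → a x ∸ bit b) (eqFin-refl x)) (cong (_∸ 1) a-x)
  same-rest : ∀ y → (if eqFin x y then 1 else a y !) ≡ (if eqFin x y then 1 else lower a x y !)
  same-rest y with x F.≟ y
  ... | yes _ = refl
  ... | no  _ = refl

#words-suc : ∀ q {M} (a : Fin M → ℕ) →
  #words (suc q) M a ≡ Σ[ M ] (λ x → bit (positive (a x)) * #words q M (lower a x))
#words-suc q {M} a = trans (sumL-funcs-suc q (allFin M) _) (sumL-cong (allFin M) λ x →
  trans (sumL-cong (funcs q (allFin M)) (λ k → trans (cong bit (occurrences-cons-≡ a x k)) (bit-∧ (positive (a x)) _)))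
        (sumL-*ˡ (funcs q (allFin M)) (bit (positive (a x))) _))

-- #words q M a · ∏ a_x! = q!, by induction on q: the words starting with x
-- are the words of length q with multiplicities lower a x.
#words-* : ∀ q {M} (a : Fin M → ℕ) → Σ[ M ] a ≡ q → #words q M a * prodFact a ≡ q !
#words-* zero {M} a Σa≡0 = begin
  #words 0 M a * prodFact a
    ≡⟨ cong₂ (λ b n → (bit b + 0) * n) (eqF-intro eqℕ {f = λ _ → 0} {a} (λ y → eqℕ-intro (sym (a≡0 y))))
                                        (Π-cong M (λ y → cong _! (a≡0 y))) ⟩
  1 * Π[ M ] (λ _ → 1)      ≡⟨ trans (*-identityˡ _) (Π-const-1 M) ⟩
  1                         ∎
  where
  open ≡-Reasoning
  a≡0 : ∀ y → a y ≡ 0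
  a≡0 y = n≤0⇒n≡0 (subst (a y ≤_) Σa≡0 (summand-≤ M a y))
#words-* (suc q) {M} a Σa≡1+q = begin
  #words (suc q) M a * prodFact a                                         ≡⟨ cong (_* prodFact a) (#words-suc q a) ⟩
  Σ[ M ] (λ x → bit (positive (a x)) * #words q M (lower a x)) * prodFact a ≡⟨ sym (sumL-*ʳ (allFin M) (prodFact a) _) ⟩
  Σ[ M ] (λ x → bit (positive (a x)) * #words q M (lower a x) * prodFact a) ≡⟨ sumL-cong (allFin M) (λ x → first-letter x (a x) refl) ⟩
  Σ[ M ] (λ x → a x * q !)                                                ≡⟨ sumL-*ʳ (allFin M) (q !) a ⟩
  Σ[ M ] a * q !                                                          ≡⟨ cong (_* q !) Σa≡1+q ⟩
  suc q !                                                                 ∎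
  where
  open ≡-Reasoning
  first-letter : ∀ x n → a x ≡ n → bit (positive (a x)) * #words q M (lower a x) * prodFact a ≡ a x * q !
  first-letter x zero    a-x rewrite a-x = refl
  first-letter x (suc t) a-x rewrite a-x = begin
    1 * #words q M (lower a x) * prodFact a
      ≡⟨ cong₂ _*_ (*-identityˡ (#words q M (lower a x))) (prodFact-lower a x t a-x) ⟩
    #words q M (lower a x) * (suc t * prodFact (lower a x))     ≡⟨ *-left-comm (#words q M (lower a x)) (suc t) _ ⟩
    suc t * (#words q M (lower a x) * prodFact (lower a x))     ≡⟨ cong (suc t *_) (#words-* q (lower a x) Σlower≡q) ⟩
    suc t * q !                                                 ∎
    where
    Σlower≡q : Σ[ M ] (lower a x) ≡ q
    Σlower≡q = suc-injective (trans (sym (Σ-lower a x (subst (λ n → positive n ≡ true) (sym a-x) refl))) Σa≡1+q)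

multinomial≡#words : ∀ q {M} (a : Fin M → ℕ) → Σ[ M ] a ≡ q → multinomial q a ≡ #words q M a
multinomial≡#words q {M} a Σa≡q =
  trans (cong (λ n → (n / prodFact a) {{prodFact-nonZero a}}) (sym (#words-* q a Σa≡q)))
        (m*n/n≡m (#words q M a) (prodFact a) {{prodFact-nonZero a}})

upTo-occursOnce : ∀ m v → v < m → OccursOnce eqℕ (upTo m) v
upTo-occursOnce m v v<m = begin
  sumL (upTo m) (λ x → bit (eqℕ v x))      ≡⟨ sumL-applyUpTo id m _ ⟩
  Σ[ m ] (λ i → bit (eqℕ v (toℕ i)))       ≡⟨ sumL-cong (allFin m) (λ i → cong bit (same-test i)) ⟩
  Σ[ m ] (λ i → bit (eqFin (fromℕ< v<m) i)) ≡⟨ Σ-delta-1 m (fromℕ< v<m) ⟩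
  1                                         ∎
  where
  open ≡-Reasoning
  sumL-applyUpTo : ∀ (f : ℕ → ℕ) m (w : ℕ → ℕ) → sumL (applyUpTo f m) w ≡ Σ[ m ] (λ i → w (f (toℕ i)))
  sumL-applyUpTo f zero    w = refl
  sumL-applyUpTo f (suc m) w =
    trans (cong (w (f 0) +_) (sumL-applyUpTo (f ∘ suc) m w)) (sym (Σ-suc m (λ i → w (f (toℕ i)))))
  fromℕ<-≡ : ∀ {u} (u<m : u < m) i → u ≡ toℕ i → fromℕ< u<m ≡ i
  fromℕ<-≡ u<m i refl = FP.fromℕ<-toℕ i u<m
  same-test : ∀ i → eqℕ v (toℕ i) ≡ eqFin (fromℕ< v<m) i
  same-test i = bool-ext
    (λ e → eqFin-intro (fromℕ<-≡ v<m i (eqℕ-true e)))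
    (λ e → eqℕ-intro (trans (sym (FP.toℕ-fromℕ< v<m)) (cong toℕ (eqFin-true e))))

-- The multiplicity vectors of words of length q over Fin M, listed as in `families`.
vectors : (M q : ℕ) → List (Fin M → ℕ)
vectors M q = filter (λ a → Σ[ M ] a N.≟ q) (funcs M (upTo (suc q)))

vectors-occursOnce : ∀ q M (k : Fin q → Fin M) → OccursOnce (eqF eqℕ) (vectors M q) (occurrences k)
vectors-occursOnce q M k = begin
  sumL (vectors M q) (λ a → bit (eqF eqℕ (occurrences k) a))
    ≡⟨ sumL-filter (λ a → Σ[ M ] a N.≟ q) (funcs M (upTo (suc q))) _ ⟩
  sumL (funcs M (upTo (suc q))) (λ a → bit (does (Σ[ M ] a N.≟ q)) * bit (eqF eqℕ (occurrences k) a))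
    ≡⟨ sumL-cong (funcs M (upTo (suc q))) total-is-q ⟩
  sumL (funcs M (upTo (suc q))) (λ a → bit (eqF eqℕ (occurrences k) a))
    ≡⟨ funcs-occursOnce M {eqℕ} (occurrences k) (λ y → upTo-occursOnce (suc q) _ (s≤s (occurrences-≤ k y))) ⟩
  1 ∎
  where
  open ≡-Reasoning
  total-is-q : ∀ a → bit (does (Σ[ M ] a N.≟ q)) * bit (eqF eqℕ (occurrences k) a) ≡ bit (eqF eqℕ (occurrences k) a)
  total-is-q a with eqF eqℕ (occurrences k) a B.≟ true
  ... | no ¬occ rewrite bool-false ¬occ = *-zeroʳ (bit (does (Σ[ M ] a N.≟ q)))
  ... | yes occ rewrite occ = cong (λ b → bit b * 1) (dec-true (Σ[ M ] a N.≟ q)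
          (trans (sumL-cong (allFin M) (λ y → sym (eqℕ-true (eqF-true eqℕ {f = occurrences k} {a} occ y))))
                 (occurrences-total k)))

sum-by-multiplicities : ∀ q M (W : (Fin M → ℕ) → ℕ) → Extensional W →
  sumL (funcs q (allFin M)) (λ k → W (occurrences k)) ≡ sumL (vectors M q) (λ a → multinomial q a * W a)
sum-by-multiplicities q M W W-ext = begin
  sumL words (λ k → W (occurrences k))
    ≡⟨ sumL-cong words (λ k → sym (trans (cong (_* W (occurrences k)) (vectors-occursOnce q M k)) (+-identityʳ _))) ⟩
  sumL words (λ k → sumL (vectors M q) (λ a → is k a) * W (occurrences k))
    ≡⟨ sumL-cong words (λ k → sym (sumL-*ʳ (vectors M q) (W (occurrences k)) _)) ⟩
  sumL words (λ k → sumL (vectors M q) (λ a → is k a * W (occurrences k)))  ≡⟨ sumL-swap words (vectors M q) _ ⟩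
  sumL (vectors M q) (λ a → sumL words (λ k → is k a * W (occurrences k)))
    ≡⟨ sumL-cong (vectors M q) (λ a → sumL-cong words (λ k → bit-*-cong (eqF eqℕ (occurrences k) a) (W-at k a))) ⟩
  sumL (vectors M q) (λ a → sumL words (λ k → is k a * W a))    ≡⟨ sumL-cong (vectors M q) (λ a → sumL-*ʳ words (W a) _) ⟩
  sumL (vectors M q) (λ a → #words q M a * W a)
    ≡⟨ sumL-filter-cong (λ a → Σ[ M ] a N.≟ q) (funcs M (upTo (suc q)))
                        (λ a Σa≡q → cong (_* W a) (sym (multinomial≡#words q a Σa≡q))) ⟩
  sumL (vectors M q) (λ a → multinomial q a * W a)              ∎
  where
  open ≡-Reasoning
  words : List (Fin q → Fin M)
  words = funcs q (allFin M)
  is : (Fin q → Fin M) → (Fin M → ℕ) → ℕ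
  is k a = bit (eqF eqℕ (occurrences k) a)
  W-at : ∀ k a → eqF eqℕ (occurrences k) a ≡ true → W (occurrences k) ≡ W a
  W-at k a e = W-ext _ _ (λ y → eqℕ-true (eqF-true eqℕ {f = occurrences k} {a} e y))

IsGraph : ∀ {n} → Matrix n → (Fin n → Fin n) → Set
IsGraph M s = ∀ r c → M r c ≡ eqFin (s r) c

-- A column containing a 1 in row r (r itself if there is none).
column : ∀ {n} → Matrix n → Fin n → Fin n
column M r with FP.any? (λ c → M r c B.≟ true)
... | yes (c , _) = c
... | no  _       = r

column-true : ∀ {n} (M : Matrix n) r c → M r c ≡ true → M r (column M r) ≡ true
column-true M r c Mrc with FP.any? (λ c → M r c B.≟ true)
... | yes (_ , Mrc') = Mrc'
... | no  none       = ⊥-elim (none (c , Mrc))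

all-false : ∀ m (f : Fin m → Bool) → Σ[ m ] (λ j → bit (f j)) ≡ 0 → ∀ j → f j ≡ false
all-false m f Σf≡0 j = bit≡0 (n≤0⇒n≡0 (subst (bit (f j) ≤_) Σf≡0 (summand-≤ m (λ j → bit (f j)) j)))
  where
  bit≡0 : ∀ {b} → bit b ≡ 0 → b ≡ false
  bit≡0 {false} _ = refl

single-true : ∀ m (f : Fin m → Bool) → Σ[ m ] (λ j → bit (f j)) ≡ 1 → Σ (Fin m) (λ j₀ → ∀ j → f j ≡ eqFin j₀ j)
single-true (suc m) f Σf≡1 = by-first (f F.zero) refl
  where
  split : bit (f F.zero) + Σ[ m ] (λ j → bit (f (F.suc j))) ≡ 1
  split = trans (sym (Σ-suc m (λ j → bit (f j)))) Σf≡1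
  rest : ∀ {b} → f F.zero ≡ b → bit b + Σ[ m ] (λ j → bit (f (F.suc j))) ≡ 1
  rest f0 = trans (cong (λ b → bit b + Σ[ m ] (λ j → bit (f (F.suc j)))) (sym f0)) split
  by-first : ∀ b → f F.zero ≡ b → Σ (Fin (suc m)) (λ j₀ → ∀ j → f j ≡ eqFin j₀ j)
  by-first true  f0 = F.zero , λ { F.zero → f0 ; (F.suc j) → all-false m (f ∘ F.suc) (suc-injective (rest f0)) j }
  by-first false f0 with single-true m (f ∘ F.suc) (rest f0)
  ... | j₀ , delta = F.suc j₀ , λ { F.zero → f0 ; (F.suc j) → trans (delta j) (sym (eqFin-suc j₀ j)) }

IsGraph-column : ∀ {n} (M : Matrix n) → (∀ r → Σ[ n ] (λ c → bit (M r c)) ≡ 1) → IsGraph M (column M)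
IsGraph-column {n} M rows r c with single-true n (M r) (rows r)
... | c₀ , delta = trans (delta c) (cong (λ c' → eqFin c' c) c₀≡column)
  where
  c₀≡column : c₀ ≡ column M r
  c₀≡column = eqFin-true (trans (sym (delta (column M r))) (column-true M r c₀ (trans (delta c₀) (eqFin-refl c₀))))

column-graph : ∀ {n} {M : Matrix n} {s} → IsGraph M s → ∀ r → column M r ≡ s r
column-graph {M = M} {s} graph r =
  sym (eqFin-true (trans (sym (graph r (column M r))) (column-true M r (s r) (trans (graph r (s r)) (eqFin-refl (s r))))))

graph-rows : ∀ {n} {M : Matrix n} {s} → IsGraph M s → ∀ r → Σ[ n ] (λ c → bit (M r c)) ≡ 1
graph-rows {n} {s = s} graph r = trans (sumL-cong (allFin n) (λ c → cong bit (graph r c))) (Σ-delta-1 n (s r))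

single-true-unique : ∀ m (f : Fin m → Bool) → Σ[ m ] (λ j → bit (f j)) ≡ 1 →
  ∀ {j j'} → f j ≡ true → f j' ≡ true → j ≡ j'
single-true-unique m f Σf≡1 {j} {j'} fj fj' with single-true m f Σf≡1
... | j₀ , delta = trans (sym (eqFin-true {i = j₀} (trans (sym (delta j)) fj))) (eqFin-true {i = j₀} (trans (sym (delta j')) fj'))

injective⇒surjective : ∀ {m} (f : Fin m → Fin m) → IsInjective f → ∀ j → Σ (Fin m) (λ i → f i ≡ j)
injective⇒surjective f inj j with FP.any? (λ i → f i F.≟ j)
... | yes hit = hit
injective⇒surjective {suc m} f inj j | no miss = ⊥-elim (<-irrefl refl (FP.injective⇒≤ {f = squeeze} squeeze-injective))
  where
  -- f misses j, so it factors through Fin m by closing the gap at j.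
  squeeze : Fin (suc m) → Fin m
  squeeze i = punchOut {i = j} {j = f i} (λ e → miss (i , sym e))
  squeeze-injective : ∀ {x y} → squeeze x ≡ squeeze y → x ≡ y
  squeeze-injective {x} {y} e = inj x y (FP.punchOut-injective (λ e₁ → miss (x , sym e₁)) (λ e₁ → miss (y , sym e₁)) e)

module Blocks (p q : ℕ) where

  pair : Fin p → Fin q → Fin (p * q)
  pair = combine

  pair-injective : ∀ {i a j b} → pair i a ≡ pair j b → (i ≡ j) × (a ≡ b)
  pair-injective {i} {a} {j} {b} = FP.combine-injective i a j b

  ∀-pair : (P : Fin (p * q) → Set) → (∀ i a → P (pair i a)) → ∀ r → P r
  ∀-pair P h r = subst P (FP.combine-remQuot {p} q r) (h _ _)

  partialTranspose-pair : ∀ M i a j b → partialTranspose p q M (pair i a) (pair j b) ≡ M (pair i b) (pair j a)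
  partialTranspose-pair M i a j b =
    cong₂ M (cong₂ combine (cong proj₁ (FP.remQuot-combine i a)) (cong proj₂ (FP.remQuot-combine j b)))
            (cong₂ combine (cong proj₁ (FP.remQuot-combine j b)) (cong proj₂ (FP.remQuot-combine i a)))

  -- Block data: π a permutes the blocks at offset a, g i permutes the offsets in block i.
  Perms : Set
  Perms = Fin q → Fin p → Fin p

  Invs : Set
  Invs = Fin p → Fin q → Fin q

  blockMap : Perms → Invs → Fin (p * q) → Fin (p * q)
  blockMap π g r = at (remQuot {p} q r)
    where
    at : Fin p × Fin q → Fin (p * q)
    at (i , a) = pair (π a i) (g i a)

  blockMap-pair : ∀ π g i a → blockMap π g (pair i a) ≡ pair (π a i) (g i a)
  blockMap-pair π g i a = cong (λ z → pair (π (proj₂ z) (proj₁ z)) (g (proj₁ z) (proj₂ z))) (FP.remQuot-combine i a)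

  Coherent : Perms → Invs → Set
  Coherent π g = ∀ i b → (g i (g i b) ≡ b) × (π (g i b) i ≡ π b i)

  IsSymmetric : Matrix (p * q) → Set
  IsSymmetric M = ∀ r c → partialTranspose p q M r c ≡ M r c

  ColumnSums1 : Matrix (p * q) → Set
  ColumnSums1 M = ∀ c → Σ[ p * q ] (λ r → bit (M r c)) ≡ 1

  module OnGraph {M : Matrix (p * q)} {π : Perms} {g : Invs} (graph : IsGraph M (blockMap π g)) where

    entry : ∀ i a c → M (pair i a) c ≡ eqFin (pair (π a i) (g i a)) c
    entry i a c = trans (graph (pair i a) c) (cong (λ r → eqFin r c) (blockMap-pair π g i a))

    entry-true : ∀ {i a j b} → M (pair i a) (pair j b) ≡ true → (π a i ≡ j) × (g i a ≡ b)
    entry-true {i} {a} {j} {b} e = pair-injective (eqFin-true (trans (sym (entry i a (pair j b))) e))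

    entry-intro : ∀ {i a j b} → π a i ≡ j → g i a ≡ b → M (pair i a) (pair j b) ≡ true
    entry-intro {i} {a} refl refl = trans (entry i a _) (eqFin-refl (pair (π a i) (g i a)))

    -- By symmetry the 1 of row (i, b) also lies at (i, g i b) ↦ (π b i, b).
    mirrored : IsSymmetric M → ∀ i b → M (pair i (g i b)) (pair (π b i) b) ≡ true
    mirrored symM i b = trans (sym (symM (pair i (g i b)) (pair (π b i) b)))
                             (trans (partialTranspose-pair M i (g i b) (π b i) b) (entry-intro refl refl))

    symmetric→coherent : IsSymmetric M → Coherent π g
    symmetric→coherent symM i b with entry-true (mirrored symM i b)
    ... | πgb≡πb , ggb≡b = ggb≡b , πgb≡πb

    symmetric→injective : IsSymmetric M → ColumnSums1 M → ∀ b → IsInjective (π b)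
    symmetric→injective symM cols b i i' πi≡πi' = proj₁ (pair-injective same-row)
      where
      same-row : pair i (g i b) ≡ pair i' (g i' b)
      same-row = single-true-unique (p * q) (λ r → M r (pair (π b i) b)) (cols _)
                   (mirrored symM i b) (subst (λ j → M (pair i' (g i' b)) (pair j b) ≡ true) (sym πi≡πi') (mirrored symM i' b))

    -- Half of the symmetry: a 1 at ((i, b), (j, a)) forces a 1 at ((i, a), (j, b)).
    coherent-mirror : Coherent π g → ∀ i a j b → M (pair i b) (pair j a) ≡ true → M (pair i a) (pair j b) ≡ true
    coherent-mirror coh i a j b e with entry-true e
    ... | πbi≡j , gib≡a = entry-intro (trans (cong (λ a' → π a' i) (sym gib≡a)) (trans (proj₂ (coh i b)) πbi≡j))
                                      (trans (cong (g i) (sym gib≡a)) (proj₁ (coh i b)))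

    coherent→symmetric : Coherent π g → IsSymmetric M
    coherent→symmetric coh = ∀-pair _ λ i a → ∀-pair _ λ j b →
      trans (partialTranspose-pair M i a j b) (bool-ext (coherent-mirror coh i a j b) (coherent-mirror coh i b j a))

    -- Column (j, b) has its only 1 in row (i₀, g i₀ b), where π b i₀ = j.
    injective→columns : Coherent π g → (∀ b → IsInjective (π b)) → ColumnSums1 M
    injective→columns coh inj = ∀-pair _ column-sum
      where
      column-sum : ∀ j b → Σ[ p * q ] (λ r → bit (M r (pair j b))) ≡ 1
      column-sum j b with injective⇒surjective (π b) (inj b) j
      ... | i₀ , πi₀≡j = trans (sumL-cong (allFin (p * q)) (λ r → cong bit (delta r))) (Σ-delta-1 (p * q) (pair i₀ (g i₀ b)))
        where
        to : ∀ i a → M (pair i a) (pair j b) ≡ true → pair i₀ (g i₀ b) ≡ pair i a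
        to i a e with entry-true e
        ... | πai≡j , gia≡b =
          cong₂ pair i₀≡i (trans (cong (g i₀) (sym gia≡b)) (trans (cong (λ i' → g i' (g i a)) i₀≡i) (proj₁ (coh i a))))
          where
          i₀≡i : i₀ ≡ i
          i₀≡i = inj b i₀ i (trans πi₀≡j (trans (sym πai≡j)
                   (trans (cong (λ a' → π a' i) (trans (sym (proj₁ (coh i a))) (cong (g i) gia≡b))) (proj₂ (coh i b)))))
        from : ∀ i a → pair i₀ (g i₀ b) ≡ pair i a → M (pair i a) (pair j b) ≡ true
        from i a e with pair-injective e
        ... | refl , refl = entry-intro (trans (proj₂ (coh i₀ b)) πi₀≡j) (proj₁ (coh i₀ b))
        delta : ∀ r → M r (pair j b) ≡ eqFin (pair i₀ (g i₀ b)) r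
        delta = ∀-pair _ λ i a → bool-ext (λ e → eqFin-intro (to i a e)) (λ e → from i a (eqFin-true e))

  Data : Set
  Data = Perms × Invs

  colouring : Perms → Fin p → Fin q → Fin p
  colouring π i b = π b i

  coherentAt? : Perms → Fin p → (Fin q → Fin q) → Bool
  coherentAt? π i = ColouredInvolutions.sInvolution? (colouring π i) (λ _ → true)

  allInjective? : Perms → Bool
  allInjective? π = allB (λ b → does (isInjective? (π b)))

  admissible? : Data → Bool
  admissible? (π , g) = allInjective? π ∧ allB (λ i → coherentAt? π i (g i))

  admissible-true : ∀ π g → admissible? (π , g) ≡ true → (∀ b → IsInjective (π b)) × Coherent π g
  admissible-true π g e =
    (λ b → does-true (isInjective? (π b)) (allB-true _ (∧-true₁ e) b)) ,
    (λ i b → let gᵢ = ColouredInvolutions.sInvolution-true (colouring π i) _ (g i)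
                        (allB-true _ (∧-true₂ {allInjective? π} e) i) b
             in proj₁ gᵢ , proj₁ (proj₂ gᵢ))

  admissible-intro : ∀ π g → (∀ b → IsInjective (π b)) → Coherent π g → admissible? (π , g) ≡ true
  admissible-intro π g inj coh =
    ∧-intro (allB-intro _ (λ b → dec-true (isInjective? (π b)) (inj b)))
            (allB-intro _ (λ i → ColouredInvolutions.sInvolution-intro (colouring π i) _ (g i)
                                   (λ b → proj₁ (coh i b) , proj₂ (coh i b) , λ ())))

  isSymmetricPermutation? : Matrix (p * q) → Bool
  isSymmetricPermutation? M = does (isPermutationMatrix? M ×-dec matEq? (partialTranspose p q M) M)

  graphOf : Data → Matrix (p * q)
  graphOf (π , g) r c = eqFin (blockMap π g r) c

  decode : Matrix (p * q) → Data
  decode M = (λ a i → proj₁ (remQuot {p} q (column M (pair i a)))) ,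
             (λ i a → proj₂ (remQuot {p} q (column M (pair i a))))

  eqBool : Bool → Bool → Bool
  eqBool a b = does (a B.≟ b)

  eqMatrix : Matrix (p * q) → Matrix (p * q) → Bool
  eqMatrix = eqF (eqF eqBool)

  eqData : Data → Data → Bool
  eqData (π , g) (π' , g') = eqF (eqF eqFin) π π' ∧ eqF (eqF eqFin) g g'

  eqF²-≗ : ∀ {m n k} {f f' : Fin m → Fin n → Fin k} → eqF (eqF eqFin) f f' ≡ true → ∀ a i → f a i ≡ f' a i
  eqF²-≗ {f = f} {f'} e a = eqF-≗ (eqF-true (eqF eqFin) {f = f} {f'} e a)

  ≗-eqF² : ∀ {m n k} {f f' : Fin m → Fin n → Fin k} → (∀ a i → f a i ≡ f' a i) → eqF (eqF eqFin) f f' ≡ true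
  ≗-eqF² {f = f} {f'} e = eqF-intro (eqF eqFin) {f = f} {f'} (λ a → ≗-eqF (e a))

  decode-graph : ∀ {M π g} → IsGraph M (blockMap π g) → ∀ i a → remQuot {p} q (column M (pair i a)) ≡ (π a i , g i a)
  decode-graph {M} {π} {g} graph i a =
    trans (cong (remQuot q) (trans (column-graph {M = M} {blockMap π g} graph (pair i a)) (blockMap-pair π g i a)))
          (FP.remQuot-combine (π a i) (g i a))

  matrix→data : ∀ M π g → isSymmetricPermutation? M ∧ eqData (decode M) (π , g) ≡ true →
                admissible? (π , g) ∧ eqMatrix (graphOf (π , g)) M ≡ true
  matrix→data M π g e =
    ∧-intro (admissible-intro π g (symmetric→injective symM cols) (symmetric→coherent symM))
            (eqF-intro (eqF eqBool) {f = graphOf (π , g)} {M} (λ r → eqF-intro eqBool {f = graphOf (π , g) r} {M r}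
              (λ c → dec-true (graphOf (π , g) r c B.≟ M r c) (sym (graph r c)))))
    where
    perm,sym : IsPermutationMatrix M × IsSymmetric M
    perm,sym = does-true (isPermutationMatrix? M ×-dec matEq? (partialTranspose p q M) M) (∧-true₁ e)
    rows : ∀ r → Σ[ p * q ] (λ c → bit (M r c)) ≡ 1
    rows = proj₁ (proj₁ perm,sym)
    cols : ColumnSums1 M
    cols = proj₂ (proj₁ perm,sym)
    symM : IsSymmetric M
    symM = proj₂ perm,sym
    decoded : eqData (decode M) (π , g) ≡ true
    decoded = ∧-true₂ {isSymmetricPermutation? M} e
    column≗blockMap : ∀ r → column M r ≡ blockMap π g r
    column≗blockMap = ∀-pair _ λ i a → begin
      column M (pair i a)                                                     ≡⟨ sym (FP.combine-remQuot {p} q _) ⟩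
      pair (proj₁ (remQuot {p} q (column M (pair i a)))) (proj₂ (remQuot {p} q (column M (pair i a))))
        ≡⟨ cong₂ pair (eqF²-≗ {f = proj₁ (decode M)} {π} (∧-true₁ decoded) a i)
                      (eqF²-≗ {f = proj₂ (decode M)} {g} (∧-true₂ {eqF (eqF eqFin) (proj₁ (decode M)) π} decoded) i a) ⟩
      pair (π a i) (g i a)                                                    ≡⟨ sym (blockMap-pair π g i a) ⟩
      blockMap π g (pair i a)                                                 ∎
      where open ≡-Reasoning
    graph : IsGraph M (blockMap π g)
    graph r c = trans (IsGraph-column M rows r c) (cong (λ s → eqFin s c) (column≗blockMap r))
    open OnGraph {M} {π} {g} graph

  data→matrix : ∀ M π g → admissible? (π , g) ∧ eqMatrix (graphOf (π , g)) M ≡ true →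
                isSymmetricPermutation? M ∧ eqData (decode M) (π , g) ≡ true
  data→matrix M π g e =
    ∧-intro (dec-true (isPermutationMatrix? M ×-dec matEq? (partialTranspose p q M) M)
                      ((graph-rows {M = M} {blockMap π g} graph , injective→columns coh inj) , coherent→symmetric coh))
            (∧-intro (≗-eqF² {f = proj₁ (decode M)} {π} (λ a i → cong proj₁ (decode-graph {M} {π} {g} graph i a)))
                     (≗-eqF² {f = proj₂ (decode M)} {g} (λ i a → cong proj₂ (decode-graph {M} {π} {g} graph i a))))
    where
    inj,coh : (∀ b → IsInjective (π b)) × Coherent π g
    inj,coh = admissible-true π g (∧-true₁ e)
    inj : ∀ b → IsInjective (π b)
    inj = proj₁ inj,coh
    coh : Coherent π g
    coh = proj₂ inj,coh
    graph : IsGraph M (blockMap π g)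
    graph r c = sym (does-true (graphOf (π , g) r c B.≟ M r c)
                      (eqF-true eqBool {f = graphOf (π , g) r} {M r}
                        (eqF-true (eqF eqBool) {f = graphOf (π , g)} {M} (∧-true₂ {admissible? (π , g)} e) r) c))
    open OnGraph {M} {π} {g} graph

  matrices-enumerate : Enumerates eqMatrix (allMatrices (p * q))
  matrices-enumerate = funcs-enumerates (p * q) {eqF eqBool} (funcs-enumerates (p * q) {eqBool} bools-enumerate)
    where
    bools-enumerate : Enumerates eqBool (true ∷ false ∷ [])
    bools-enumerate true  = refl
    bools-enumerate false = refl

  permsList : List Perms
  permsList = funcs q (funcs p (allFin p))

  invsList : List Invs
  invsList = funcs p (funcs q (allFin q))

  dataList : List Data
  dataList = concatMap (λ π → map (π ,_) invsList) permsList

  sumL-dataList : (w : Data → ℕ) → sumL dataList w ≡ sumL permsList (λ π → sumL invsList (λ g → w (π , g)))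
  sumL-dataList w = trans (sumL-concatMap (λ π → map (π ,_) invsList) permsList w)
                          (sumL-cong permsList (λ π → sumL-map (π ,_) invsList w))

  dataList-enumerates : Enumerates eqData dataList
  dataList-enumerates (π , g) = begin
    sumL dataList (λ y → bit (eqData (π , g) y))                               ≡⟨ sumL-dataList _ ⟩
    sumL permsList (λ π' → sumL invsList (λ g' → bit (sameπ π' ∧ sameg g')))
      ≡⟨ sumL-cong permsList (λ π' → trans (sumL-cong invsList (λ g' → bit-∧ (sameπ π') (sameg g')))
                                            (sumL-*ˡ invsList (bit (sameπ π')) _)) ⟩
    sumL permsList (λ π' → bit (sameπ π') * sumL invsList (λ g' → bit (sameg g')))
      ≡⟨ sumL-cong permsList (λ π' → trans (cong (bit (sameπ π') *_) (enum-invs g)) (*-identityʳ _)) ⟩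
    sumL permsList (λ π' → bit (sameπ π'))                                     ≡⟨ enum-perms π ⟩
    1                                                                          ∎
    where
    open ≡-Reasoning
    sameπ : Perms → Bool
    sameπ = eqF (eqF eqFin) π
    sameg : Invs → Bool
    sameg = eqF (eqF eqFin) g
    enum-perms : Enumerates (eqF (eqF eqFin)) permsList
    enum-perms = funcs-enumerates q (funcs-enumerates p (allFin-enumerates p))
    enum-invs : Enumerates (eqF (eqF eqFin)) invsList
    enum-invs = funcs-enumerates p (funcs-enumerates q (allFin-enumerates q))

  Ze≡#admissible : Ze p q ≡ count dataList admissible?
  Ze≡#admissible = trans (length-filter _ (allMatrices (p * q)))
    (count-bijection {L₁ = allMatrices (p * q)} {dataList} {eqMatrix} {eqData} matrices-enumerate dataList-enumerates
      isSymmetricPermutation? admissible? decode graphOf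
      (λ M y → bool-ext (matrix→data M (proj₁ y) (proj₂ y)) (data→matrix M (proj₁ y) (proj₂ y))))

  -- For fixed π the g i are chosen independently among the involutions
  -- preserving the colouring b ↦ π b i.
  involutionWeight : Perms → ℕ
  involutionWeight π = Π[ p ] (λ i → Π[ p ] (λ j → Inv (Σ[ q ] (λ b → bit (eqFin (π b i) j)))))

  #admissible : count dataList admissible? ≡ sumL permsList (λ π → bit (allInjective? π) * involutionWeight π)
  #admissible = trans (sumL-dataList (λ y → bit (admissible? y))) (sumL-cong permsList λ π → begin
    sumL invsList (λ g → bit (admissible? (π , g)))
      ≡⟨ sumL-cong invsList (λ g → trans (bit-∧ (allInjective? π) _)
                                         (cong (bit (allInjective? π) *_) (bit-allB (λ i → coherentAt? π i (g i))))) ⟩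
    sumL invsList (λ g → bit (allInjective? π) * Π[ p ] (λ i → bit (coherentAt? π i (g i))))
      ≡⟨ sumL-*ˡ invsList (bit (allInjective? π)) _ ⟩
    bit (allInjective? π) * sumL invsList (λ g → Π[ p ] (λ i → bit (coherentAt? π i (g i))))
      ≡⟨ cong (bit (allInjective? π) *_) (sumL-funcs-Π p (funcs q (allFin q)) (λ i h → bit (coherentAt? π i h))) ⟩
    bit (allInjective? π) * Π[ p ] (λ i → count (funcs q (allFin q)) (coherentAt? π i))
      ≡⟨ cong (bit (allInjective? π) *_) (Π-cong p (λ i → #colour-preserving-involutions (colouring π i))) ⟩
    bit (allInjective? π) * involutionWeight π ∎)
    where open ≡-Reasoning

map-lookupL : (xs : List A) → map (lookupL xs) (allFin (length xs)) ≡ xs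
map-lookupL []       = refl
map-lookupL (x ∷ xs) = cong (x ∷_) (trans (LP.map-tabulate F.suc (lookupL (x ∷ xs)))
                                          (trans (sym (LP.map-tabulate id (lookupL xs))) (map-lookupL xs)))

module Assembly (p q : ℕ) where
  open Blocks p q

  vectorWeight : (Fin (nSym p) → ℕ) → ℕ
  vectorWeight a = Π[ p ] (λ i → Π[ p ] (λ j → I (cnt p a i j)))

  Ze≡sum-over-words : Ze p q ≡ sumL (funcs q (allFin (nSym p))) (λ k → involutionWeight (perm p ∘ k))
  Ze≡sum-over-words = begin
    Ze p q                                                             ≡⟨ Ze≡#admissible ⟩
    count dataList admissible?                                         ≡⟨ #admissible ⟩
    sumL permsList (λ π → bit (allInjective? π) * involutionWeight π)
      ≡⟨ sym (sumL-funcs-filter isInjective? q _ involutionWeight) ⟩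
    sumL (funcs q (Sym p)) involutionWeight
      ≡⟨ cong (λ L → sumL (funcs q L) involutionWeight) (sym (map-lookupL (Sym p))) ⟩
    sumL (funcs q (map (perm p) (allFin (nSym p)))) involutionWeight
      ≡⟨ sumL-funcs-map (perm p) q (allFin (nSym p)) involutionWeight weight-ext ⟩
    sumL (funcs q (allFin (nSym p))) (λ k → involutionWeight (perm p ∘ k)) ∎
    where
    open ≡-Reasoning
    weight-ext : Extensional involutionWeight
    weight-ext π π' e =
      Π-cong p (λ i → Π-cong p (λ j → cong Inv (sumL-cong (allFin q) (λ b → cong (λ f → bit (eqFin (f i) j)) (e b)))))

  cnt-occurrences : ∀ (k : Fin q → Fin (nSym p)) i j →
    cnt p (occurrences k) i j ≡ Σ[ q ] (λ b → bit (eqFin (perm p (k b) i) j))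
  cnt-occurrences k i j = begin
    Σ[ N ] (λ π → if isj π then occurrences k π else 0)           ≡⟨ sumL-cong (allFin N) (λ π → if-bit (isj π) _) ⟩
    Σ[ N ] (λ π → bit (isj π) * Σ[ q ] (λ b → bit (eqFin (k b) π)))
      ≡⟨ sumL-cong (allFin N) (λ π → sym (sumL-*ˡ (allFin q) (bit (isj π)) _)) ⟩
    Σ[ N ] (λ π → Σ[ q ] (λ b → bit (isj π) * bit (eqFin (k b) π))) ≡⟨ sumL-swap (allFin N) (allFin q) _ ⟩
    Σ[ q ] (λ b → Σ[ N ] (λ π → bit (isj π) * bit (eqFin (k b) π)))
      ≡⟨ sumL-cong (allFin q) (λ b → trans (sumL-cong (allFin N) (λ π → *-comm (bit (isj π)) _))
                                           (Σ-delta N (k b) (λ π → bit (isj π)))) ⟩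
    Σ[ q ] (λ b → bit (isj (k b)))                                  ∎
    where
    open ≡-Reasoning
    N : ℕ
    N = nSym p
    isj : Fin N → Bool
    isj π = eqFin (perm p π i) j
    if-bit : ∀ (b : Bool) (n : ℕ) → (if b then n else 0) ≡ bit b * n
    if-bit true  n = sym (+-identityʳ n)
    if-bit false n = refl

  involutionWeight≡vectorWeight : ∀ k → involutionWeight (perm p ∘ k) ≡ vectorWeight (occurrences k)
  involutionWeight≡vectorWeight k = Π-cong p (λ i → Π-cong p (λ j →
    trans (cong Inv (sym (cnt-occurrences k i j))) (sym (I≡Inv (cnt p (occurrences k) i j)))))

  vectorWeight-ext : Extensional vectorWeight
  vectorWeight-ext a a' e = Π-cong p (λ i → Π-cong p (λ j → cong I
    (sumL-cong (allFin (nSym p)) (λ π → cong (λ n → if eqFin (perm p π i) j then n else 0) (e π)))))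

-- The formula holds for all p and q.
theorem2 : (p q : ℕ) → 1 ≤ p → 1 ≤ q → Ze p q ≡ RHS p q
theorem2 p q _ _ = begin
  Ze p q                                                         ≡⟨ Ze≡sum-over-words ⟩
  sumL words (λ k → involutionWeight (perm p ∘ k))               ≡⟨ sumL-cong words involutionWeight≡vectorWeight ⟩
  sumL words (λ k → vectorWeight (occurrences k))
    ≡⟨ sum-by-multiplicities q (nSym p) vectorWeight vectorWeight-ext ⟩
  sumL (families p q) (λ a → multinomial q a * vectorWeight a)   ≡⟨⟩
  RHS p q                                                        ∎
  where
  open ≡-Reasoning
  open Assembly p q
  open Blocks p q using (involutionWeight)
  words : List (Fin q → Fin (nSym p))
  words = funcs q (allFin (nSym p))
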